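{- Let $G_1=(V_1,E_1)$ and $G_2=(V_2,E_2)$ be trivalent $2$-edge-connected graphs. Let $G$ be obtained from $G_1\sqcup G_2$ by a $2$-switch of edges $(a_1,b_1)\in E_1$ and $(a_2,b_2)\in E_2$, and let $G'$ be obtained from $G_1\sqcup G_2$ by a $2$-switch of edges $(a_1',b_1')\in E_1$ and $(a_2',b_2')\in E_2$. Then $M_G$ and $M_{G'}$ are the same matroid on $V_1\sqcup V_2$, even when $G$ and $G'$ are non-isomorphic.
   Context: Graphs are finite and undirected and may have parallel edges; trivalent means every vertex has degree $3$. A $2$-switch of edges $(a_1,b_1)\in E_1$ and $(a_2,b_2)\in E_2$ in $G_1\sqcup G_2$ deletes these two edges and adds the edges $(a_1,a_2)$ and $(b_1,b_2)$. For a graph $H=(V,E)$, $r^*$ is the rank function of the bond (cographic) matroid of $H$. For $A\subseteq V$, $\delta(A)$ is the set of edges incident to at least one vertex of $A$. The graph curve matroid $M_H$ is the matroid on $V$ whose circuits are the non-empty subsets $A\subseteq V$ that are inclusion-minimal among non-empty subsets satisfying $r^*(\delta(A))\le|A|$. -}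

module Defs where

open import Data.Nat using (ℕ; zero; suc; _+_; _≤_)
open import Data.Bool using (Bool; true; false; _∨_; not)
open import Data.Fin using (Fin; splitAt; _↑ˡ_; _↑ʳ_; _≟_)
open import Data.Fin.Subset using (Subset; _∈_; _⊆_; ∣_∣; ∁; ⊤; Nonempty)
open import Data.Fin.Subset.Properties using (_∈?_)
open import Data.Vec using (tabulate)
open import Data.List using (List; map; allFin)
open import Data.Nat.ListAction using (sum)
open import Data.Product using (_×_; _,_; proj₁; proj₂)
open import Data.Sum using (_⊎_; inj₁; inj₂)
open import Relation.Nullary using (Dec; yes; no)
open import Relation.Nullary.Decidable using (⌊_⌋)
open import Relation.Binary.PropositionalEquality using (_≡_)
open import Function.Bundles using (_⇔_)

-- A finite undirected multigraph on vertex set Fin n with m edges;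
-- edge e has (unordered) endpoints proj₁ (G e), proj₂ (G e).
Graph : ℕ → ℕ → Set
Graph n m = Fin m → Fin n × Fin n

[_≟ᵇ_] : ∀ {n} → Fin n → Fin n → ℕ
[ u ≟ᵇ v ] with u ≟ v
... | yes _ = 1
... | no  _ = 0

degree : ∀ {n m} → Graph n m → Fin n → ℕ
degree {m = m} G v =
  sum (map (λ e → [ proj₁ (G e) ≟ᵇ v ] + [ proj₂ (G e) ≟ᵇ v ]) (allFin m))

Trivalent : ∀ {n m} → Graph n m → Set
Trivalent G = ∀ v → degree G v ≡ 3

data Reach {n m} (G : Graph n m) (X : Subset m) (u : Fin n) : Fin n → Set where
  here  : Reach G X u u
  fwd   : ∀ {e} → e ∈ X → Reach G X u (proj₁ (G e)) → Reach G X u (proj₂ (G e))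
  bwd   : ∀ {e} → e ∈ X → Reach G X u (proj₂ (G e)) → Reach G X u (proj₁ (G e))

allBut : ∀ {m} → Fin m → Subset m
allBut e = tabulate (λ f → not ⌊ f ≟ e ⌋)

Connected : ∀ {n m} → Graph n m → Set
Connected G = ∀ u v → Reach G ⊤ u v

TwoEdgeConnected : ∀ {n m} → Graph n m → Set
TwoEdgeConnected G = Connected G × (∀ e u v → Reach G (allBut e) u v)

Joins : ∀ {n m} → Graph n m → Fin m → Fin n → Fin n → Set
Joins G e a b = (G e ≡ (a , b)) ⊎ (G e ≡ (b , a))

inl : ∀ {n₁} n₂ → Fin n₁ → Fin (n₁ + n₂)
inl n₂ i = i ↑ˡ n₂

inr : ∀ n₁ {n₂} → Fin n₂ → Fin (n₁ + n₂)
inr n₁ j = n₁ ↑ʳ j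

-- 2-switch of edge e₁=(a₁,b₁) ∈ E₁ and e₂=(a₂,b₂) ∈ E₂ in G₁ ⊔ G₂:
-- delete e₁, e₂ and add (a₁,a₂), (b₁,b₂). The new edge (a₁,a₂) takes the
-- slot of e₁ and (b₁,b₂) that of e₂.
twoSwitch : ∀ {n₁ n₂ m₁ m₂} → Graph n₁ m₁ → Graph n₂ m₂ →
            Fin m₁ → Fin n₁ → Fin n₁ → Fin m₂ → Fin n₂ → Fin n₂ →
            Graph (n₁ + n₂) (m₁ + m₂)
twoSwitch {n₁} {n₂} {m₁} G₁ G₂ e₁ a₁ b₁ e₂ a₂ b₂ k with splitAt m₁ k
... | inj₁ i with i ≟ e₁
...   | yes _ = inl n₂ a₁ , inr n₁ a₂
...   | no  _ = inl n₂ (proj₁ (G₁ i)) , inl n₂ (proj₂ (G₁ i))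
twoSwitch {n₁} {n₂} {m₁} G₁ G₂ e₁ a₁ b₁ e₂ a₂ b₂ k | inj₂ j with j ≟ e₂
...   | yes _ = inl n₂ b₁ , inr n₁ b₂
...   | no  _ = inr n₁ (proj₁ (G₂ j)) , inr n₁ (proj₂ (G₂ j))

δ : ∀ {n m} → Graph n m → Subset n → Subset m
δ G A = tabulate (λ e → ⌊ proj₁ (G e) ∈? A ⌋ ∨ ⌊ proj₂ (G e) ∈? A ⌋)

-- Independence in the bond (cographic) matroid: F is independent iff
-- E ∖ F is spanning in the cycle matroid, i.e. deleting F does not
-- disconnect any pair of vertices connected in H.
BondIndep : ∀ {n m} → Graph n m → Subset m → Set
BondIndep H F = ∀ u v → Reach H ⊤ u v → Reach H (∁ F) u v

-- r*(F) ≤ k, with r*(F) = max { |F'| : F' ⊆ F, F' bond-independent }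
BondRankLe : ∀ {n m} → Graph n m → Subset m → ℕ → Set
BondRankLe H F k = ∀ F' → F' ⊆ F → BondIndep H F' → ∣ F' ∣ ≤ k

Dep : ∀ {n m} → Graph n m → Subset n → Set
Dep H A = BondRankLe H (δ H A) ∣ A ∣

IsCircuit : ∀ {n m} → Graph n m → Subset n → Set
IsCircuit H A = Nonempty A × Dep H A ×
  (∀ B → Nonempty B → B ⊆ A → Dep H B → B ≡ A)

SameCurveMatroid : ∀ {n m m'} → Graph n m → Graph n m' → Set
SameCurveMatroid H H' = ∀ A → IsCircuit H A ⇔ IsCircuit H' A

{-# OPTIONS --safe #-}
module Submission where

-- A set A meeting both V₁ and V₂ is never a circuit of M_G.  Otherwise both halves
-- A₁ = A ∩ V₁ and A₂ = A ∩ V₂ are independent, witnessed by bond-independent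
-- F₁ ⊆ δ(A₁), F₂ ⊆ δ(A₂) with |F₁| > |A₁| and |F₂| > |A₂|.  These can only share the
-- two new edges xa = a₁a₂ and xb = b₁b₂, and F₁ ∪ F₂ with at most one edge removed is a
-- bond-independent subset of δ(A) of size ≥ |F₁| + |F₂| - 1 > |A|, contradicting the
-- dependence of A.
--
-- A set B ⊆ V₁ meets only edges of G₁ - e₁ and the new edges xa, xb, which together form
-- a cut and so are never both deleted by a bond-independent set.  Identifying xa and xb
-- with e₁ therefore turns bond-independent subsets of δ_G(B) into bond-independent
-- subsets of δ_{G₁}(B) of the same size, and conversely such subsets lift back to G
-- because G₂ - e₂ is connected.  Thus r*(δ_G(B)) = r*(δ_{G₁}(B)) does not depend on the
-- switched edges, and likewise for B ⊆ V₂; so both switched graphs have the same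
-- dependent one-sided sets, hence the same circuits.

open import Defs
open import Data.Nat using (ℕ; zero; suc; _+_; _≤_; _<_; z≤n; s≤s; _≤?_)
open import Data.Nat.Properties
  using (≤-trans; ≤-reflexive; +-suc; +-comm; +-identityʳ; +-mono-≤; +-monoˡ-≤; m≤m+n; <-irrefl; ≰⇒>; module ≤-Reasoning)
open import Data.Bool using (Bool; true; false; _∨_; not)
open import Data.Fin using (Fin; zero; suc; splitAt; _↑ˡ_; _↑ʳ_; _≟_)
open import Data.Fin.Properties
  using (splitAt-↑ˡ; splitAt-↑ʳ; join-splitAt; suc-injective; 0≢1+n; ¬∀⟶∃¬; all?; ↑ˡ-injective; ↑ʳ-injective)
open import Data.Fin.Subset using (Subset; _∈_; _∉_; _⊆_; ∣_∣; ⊤; ⊥; _-_; _─_; ⁅_⁆; _∪_; _∩_)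
open import Data.Fin.Subset.Properties
open import Data.Vec using ([]; _∷_; _++_; tabulate; take; drop; here; there)
open import Data.Vec.Properties using ([]=⇒lookup; lookup⇒[]=; lookup∘tabulate; lookup-++ˡ; lookup-++ʳ; take++drop≡id)
open import Data.Product using (Σ; _×_; _,_; proj₁; proj₂; map₂)
open import Data.Product.Properties using (,-injective)
open import Data.Sum using (_⊎_; inj₁; inj₂; [_,_]′; swap) renaming (map to map-⊎)
open import Data.Empty using () renaming (⊥ to ⊥₀; ⊥-elim to ⊥-elim)
open import Data.Unit using (tt) renaming (⊤ to ⊤₀)
open import Relation.Nullary using (Dec; yes; no; ¬_; ¬?)
open import Relation.Nullary.Decidable using (⌊_⌋; decidable-stable)
open import Relation.Binary.PropositionalEquality
open import Function.Base using (_∘_)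
open import Function.Bundles using (Equivalence; _⇔_; mk⇔)

private
  variable
    n m a b : ℕ

∈-tabulate⁻ : ∀ {f : Fin n → Bool} {i} → i ∈ tabulate f → f i ≡ true
∈-tabulate⁻ {f = f} {i} i∈ = trans (sym (lookup∘tabulate f i)) ([]=⇒lookup i∈)

∈-tabulate⁺ : ∀ {f : Fin n → Bool} {i} → f i ≡ true → i ∈ tabulate f
∈-tabulate⁺ {f = f} {i} fi = lookup⇒[]= i (tabulate f) (trans (lookup∘tabulate f i) fi)

module _ {p : Subset a} {q : Subset b} where

  ∈-++⁻ˡ : ∀ {i} → i ↑ˡ b ∈ p ++ q → i ∈ p
  ∈-++⁻ˡ {i} i∈ = lookup⇒[]= i p (trans (sym (lookup-++ˡ p q i)) ([]=⇒lookup i∈))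

  ∈-++⁺ˡ : ∀ {i} → i ∈ p → i ↑ˡ b ∈ p ++ q
  ∈-++⁺ˡ {i} i∈ = lookup⇒[]= (i ↑ˡ b) (p ++ q) (trans (lookup-++ˡ p q i) ([]=⇒lookup i∈))

  ∈-++⁻ʳ : ∀ {j} → a ↑ʳ j ∈ p ++ q → j ∈ q
  ∈-++⁻ʳ {j} j∈ = lookup⇒[]= j q (trans (sym (lookup-++ʳ p q j)) ([]=⇒lookup j∈))

  ∈-++⁺ʳ : ∀ {j} → j ∈ q → a ↑ʳ j ∈ p ++ q
  ∈-++⁺ʳ {j} j∈ = lookup⇒[]= (a ↑ʳ j) (p ++ q) (trans (lookup-++ʳ p q j) ([]=⇒lookup j∈))

∣p++q∣≡∣p∣+∣q∣ : ∀ (p : Subset a) (q : Subset b) → ∣ p ++ q ∣ ≡ ∣ p ∣ + ∣ q ∣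
∣p++q∣≡∣p∣+∣q∣ []          q = refl
∣p++q∣≡∣p∣+∣q∣ (true  ∷ p) q = cong suc (∣p++q∣≡∣p∣+∣q∣ p q)
∣p++q∣≡∣p∣+∣q∣ (false ∷ p) q = ∣p++q∣≡∣p∣+∣q∣ p q

x∈p─q⁻ : ∀ (p q : Subset n) {x} → x ∈ p ─ q → x ∈ p × x ∉ q
x∈p─q⁻ (true  ∷ p) (false ∷ q) here = here , λ ()
x∈p─q⁻ (true  ∷ p) (true  ∷ q) {zero} ()
x∈p─q⁻ (false ∷ p) (true  ∷ q) {zero} ()
x∈p─q⁻ (false ∷ p) (false ∷ q) {zero} ()
x∈p─q⁻ (_ ∷ p) (_ ∷ q) {suc x} (there x∈) with x∈p─q⁻ p q x∈
... | x∈p , x∉q = there x∈p , λ { (there x∈q) → x∉q x∈q }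

x∈p-y⁻ : ∀ {p : Subset n} {x y} → x ∈ p - y → x ∈ p × x ≢ y
x∈p-y⁻ {p = p} {y = y} x∈ with x∈p─q⁻ p ⁅ y ⁆ x∈
... | x∈p , x∉y = x∈p , λ { refl → x∉y (x∈⁅x⁆ y) }

∈allBut⁻ : ∀ {e i : Fin m} → i ∈ allBut e → i ≢ e
∈allBut⁻ {e = e} i∈ refl with e ≟ e | ∈-tabulate⁻ {f = λ f → not ⌊ f ≟ e ⌋} i∈
... | yes _   | ()
... | no e≢e | _ = e≢e refl

injection⇒∣p∣≤∣q∣ : ∀ (p : Subset n) (q : Subset m) (g : Fin n → Fin m) →
  (∀ {i} → i ∈ p → g i ∈ q) → (∀ {i j} → i ∈ p → j ∈ p → g i ≡ g j → i ≡ j) →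
  ∣ p ∣ ≤ ∣ q ∣
injection⇒∣p∣≤∣q∣ [] q g maps inj = z≤n
injection⇒∣p∣≤∣q∣ (false ∷ p) q g maps inj =
  injection⇒∣p∣≤∣q∣ p q (g ∘ suc) (maps ∘ there)
    (λ i∈ j∈ eq → suc-injective (inj (there i∈) (there j∈) eq))
injection⇒∣p∣≤∣q∣ (true ∷ p) q g maps inj =
  ≤-trans (s≤s (injection⇒∣p∣≤∣q∣ p (q - g zero) (g ∘ suc)
      (λ i∈ → x∈p∧x≢y⇒x∈p-y (maps (there i∈)) (λ eq → 0≢1+n (inj here (there i∈) (sym eq))))
      (λ i∈ j∈ eq → suc-injective (inj (there i∈) (there j∈) eq))))
    (x∈p⇒∣p-x∣<∣p∣ (maps here))

∣p∪q∣+∣p∩q∣≡∣p∣+∣q∣ : ∀ (p q : Subset n) → ∣ p ∪ q ∣ + ∣ p ∩ q ∣ ≡ ∣ p ∣ + ∣ q ∣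
∣p∪q∣+∣p∩q∣≡∣p∣+∣q∣ [] [] = refl
∣p∪q∣+∣p∩q∣≡∣p∣+∣q∣ (true ∷ p) (true ∷ q) = cong suc (begin
  ∣ p ∪ q ∣ + suc ∣ p ∩ q ∣  ≡⟨ +-suc ∣ p ∪ q ∣ ∣ p ∩ q ∣ ⟩
  suc (∣ p ∪ q ∣ + ∣ p ∩ q ∣) ≡⟨ cong suc (∣p∪q∣+∣p∩q∣≡∣p∣+∣q∣ p q) ⟩
  suc (∣ p ∣ + ∣ q ∣)         ≡⟨ +-suc ∣ p ∣ ∣ q ∣ ⟨
  ∣ p ∣ + suc ∣ q ∣           ∎)
  where open ≡-Reasoning
∣p∪q∣+∣p∩q∣≡∣p∣+∣q∣ (true  ∷ p) (false ∷ q) = cong suc (∣p∪q∣+∣p∩q∣≡∣p∣+∣q∣ p q)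
∣p∪q∣+∣p∩q∣≡∣p∣+∣q∣ (false ∷ p) (true  ∷ q) =
  trans (cong suc (∣p∪q∣+∣p∩q∣≡∣p∣+∣q∣ p q)) (sym (+-suc ∣ p ∣ ∣ q ∣))
∣p∪q∣+∣p∩q∣≡∣p∣+∣q∣ (false ∷ p) (false ∷ q) = ∣p∪q∣+∣p∩q∣≡∣p∣+∣q∣ p q

∣p∪q∣≤∣p∣+∣q∣ : ∀ (p q : Subset n) → ∣ p ∪ q ∣ ≤ ∣ p ∣ + ∣ q ∣
∣p∪q∣≤∣p∣+∣q∣ p q = subst (∣ p ∪ q ∣ ≤_) (∣p∪q∣+∣p∩q∣≡∣p∣+∣q∣ p q) (m≤m+n ∣ p ∪ q ∣ ∣ p ∩ q ∣)

∣p∣+∣q∣≤∣r∣+∣s∣ : ∀ (p q r s : Subset n) → p ∪ q ⊆ r → p ∩ q ⊆ s → ∣ p ∣ + ∣ q ∣ ≤ ∣ r ∣ + ∣ s ∣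
∣p∣+∣q∣≤∣r∣+∣s∣ p q r s ∪⊆r ∩⊆s =
  subst (_≤ ∣ r ∣ + ∣ s ∣) (∣p∪q∣+∣p∩q∣≡∣p∣+∣q∣ p q) (+-mono-≤ (p⊆q⇒∣p∣≤∣q∣ ∪⊆r) (p⊆q⇒∣p∣≤∣q∣ ∩⊆s))

module _ (F₁ F₂ F : Subset n) (z : Fin n)
         (meet : ∀ {i} → i ∈ F₁ → i ∈ F₂ → i ≡ z)
         (kept : ∀ {i} → i ∈ F₁ ⊎ i ∈ F₂ → i ≢ z → i ∈ F) where

  private
    ∪⊆F∪z : F₁ ∪ F₂ ⊆ F ∪ ⁅ z ⁆
    ∪⊆F∪z {i} i∈ with i ≟ z
    ... | yes refl = q⊆p∪q F ⁅ z ⁆ (x∈⁅x⁆ z)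
    ... | no i≢z   = p⊆p∪q ⁅ z ⁆ (kept (x∈p∪q⁻ F₁ F₂ i∈) i≢z)

    ∩⊆z : F₁ ∩ F₂ ⊆ ⁅ z ⁆
    ∩⊆z i∈ with x∈p∩q⁻ F₁ F₂ i∈
    ... | i∈F₁ , i∈F₂ = subst (_∈ ⁅ z ⁆) (sym (meet i∈F₁ i∈F₂)) (x∈⁅x⁆ z)

  glue-bound-shared : z ∈ F₁ → z ∈ F₂ → z ∈ F → ∣ F₁ ∣ + ∣ F₂ ∣ ≤ ∣ F ∣ + 1
  glue-bound-shared z∈F₁ z∈F₂ z∈F =
    subst (∣ F₁ ∣ + ∣ F₂ ∣ ≤_) (cong (∣ F ∣ +_) (∣⁅x⁆∣≡1 z)) (∣p∣+∣q∣≤∣r∣+∣s∣ F₁ F₂ F ⁅ z ⁆ ∪⊆F ∩⊆z)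
    where
    ∪⊆F : F₁ ∪ F₂ ⊆ F
    ∪⊆F i∈ with x∈p∪q⁻ F (⁅ z ⁆) (∪⊆F∪z i∈)
    ... | inj₁ i∈F = i∈F
    ... | inj₂ i∈z = subst (_∈ F) (sym (x∈⁅y⁆⇒x≡y z i∈z)) z∈F

  glue-bound-unshared : ¬ (z ∈ F₁ × z ∈ F₂) → ∣ F₁ ∣ + ∣ F₂ ∣ ≤ ∣ F ∣ + 1
  glue-bound-unshared unshared = begin
    ∣ F₁ ∣ + ∣ F₂ ∣         ≤⟨ ∣p∣+∣q∣≤∣r∣+∣s∣ F₁ F₂ (F ∪ ⁅ z ⁆) ⊥ ∪⊆F∪z ∩⊆⊥ ⟩
    ∣ F ∪ ⁅ z ⁆ ∣ + ∣ ⊥ {n} ∣ ≡⟨ cong (∣ F ∪ ⁅ z ⁆ ∣ +_) (∣⊥∣≡0 n) ⟩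
    ∣ F ∪ ⁅ z ⁆ ∣ + 0       ≡⟨ +-identityʳ _ ⟩
    ∣ F ∪ ⁅ z ⁆ ∣           ≤⟨ ∣p∪q∣≤∣p∣+∣q∣ F ⁅ z ⁆ ⟩
    ∣ F ∣ + ∣ ⁅ z ⁆ ∣       ≡⟨ cong (∣ F ∣ +_) (∣⁅x⁆∣≡1 z) ⟩
    ∣ F ∣ + 1               ∎
    where
    open ≤-Reasoning
    ∩⊆⊥ : F₁ ∩ F₂ ⊆ ⊥ {n}
    ∩⊆⊥ i∈ with x∈p∩q⁻ F₁ F₂ i∈
    ... | i∈F₁ , i∈F₂ with meet i∈F₁ i∈F₂
    ... | refl = ⊥-elim (unshared (i∈F₁ , i∈F₂))

  glue-bound : (z ∈ F₁ → z ∈ F₂ → z ∈ F) → ∣ F₁ ∣ + ∣ F₂ ∣ ≤ ∣ F ∣ + 1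
  glue-bound shared⇒z∈F with z ∈? F₁ | z ∈? F₂
  ... | yes z∈F₁ | yes z∈F₂ = glue-bound-shared z∈F₁ z∈F₂ (shared⇒z∈F z∈F₁ z∈F₂)
  ... | no z∉F₁  | _        = glue-bound-unshared (z∉F₁ ∘ proj₁)
  ... | yes _    | no z∉F₂  = glue-bound-unshared (z∉F₂ ∘ proj₂)

glue-absurd : ∀ {a₁ a₂ f₁ f₂ f a} → a₁ < f₁ → a₂ < f₂ → f₁ + f₂ ≤ f + 1 → f ≤ a → a ≤ a₁ + a₂ → ⊥₀
glue-absurd {a₁} {a₂} {f₁} {f₂} {f} a₁<f₁ a₂<f₂ glued f≤a a≤ = <-irrefl refl (begin-strict
  suc (a₁ + a₂)     <⟨ s≤s (≤-reflexive (sym (+-suc a₁ a₂))) ⟩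
  suc a₁ + suc a₂   ≤⟨ +-mono-≤ a₁<f₁ a₂<f₂ ⟩
  f₁ + f₂           ≤⟨ glued ⟩
  f + 1             ≤⟨ +-monoˡ-≤ 1 (≤-trans f≤a a≤) ⟩
  (a₁ + a₂) + 1     ≡⟨ +-comm (a₁ + a₂) 1 ⟩
  suc (a₁ + a₂)     ∎)
  where open ≤-Reasoning

data Side a b : Fin (a + b) → Set where
  left  : (i : Fin a) → Side a b (i ↑ˡ b)
  right : (j : Fin b) → Side a b (a ↑ʳ j)

side : ∀ a b (k : Fin (a + b)) → Side a b k
side a b k with splitAt a k | join-splitAt a b k
... | inj₁ i | eq = subst (Side a b) eq (left i)
... | inj₂ j | eq = subst (Side a b) eq (right j)

↑ˡ≢↑ʳ : ∀ {i : Fin a} {j : Fin b} → i ↑ˡ b ≢ a ↑ʳ j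
↑ˡ≢↑ʳ {a} {b} {i} {j} eq with trans (sym (splitAt-↑ˡ a i b)) (trans (cong (splitAt a) eq) (splitAt-↑ʳ a b j))
... | ()

↑ˡ-inj : ∀ {i i' : Fin a} → i ↑ˡ b ≡ i' ↑ˡ b → i ≡ i'
↑ˡ-inj {b = b} = ↑ˡ-injective b _ _

↑ʳ-inj : ∀ {j j' : Fin b} → a ↑ʳ j ≡ a ↑ʳ j' → j ≡ j'
↑ʳ-inj {a = a} = ↑ʳ-injective a _ _

left-or : Fin a → Fin (a + b) → Fin a
left-or {a} d k with splitAt a k
... | inj₁ i = i
... | inj₂ _ = d

left-or-↑ˡ : ∀ (d i : Fin a) → left-or {b = b} d (i ↑ˡ b) ≡ i
left-or-↑ˡ {a} {b} d i rewrite splitAt-↑ˡ a i b = refl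

left-or-↑ʳ : ∀ (d : Fin a) (j : Fin b) → left-or d (a ↑ʳ j) ≡ d
left-or-↑ʳ {a} {b} d j rewrite splitAt-↑ʳ a b j = refl

right-or : ∀ a → Fin b → Fin (a + b) → Fin b
right-or a d k with splitAt a k
... | inj₁ _ = d
... | inj₂ j = j

right-or-↑ˡ : ∀ (d : Fin b) (i : Fin a) → right-or a d (i ↑ˡ b) ≡ d
right-or-↑ˡ {b} {a} d i rewrite splitAt-↑ˡ a i b = refl

right-or-↑ʳ : ∀ a (d j : Fin b) → right-or a d (a ↑ʳ j) ≡ j
right-or-↑ʳ {b} a d j rewrite splitAt-↑ʳ a b j = refl

OnLeft : ∀ a → Subset (a + b) → Set
OnLeft a p = ∀ j → a ↑ʳ j ∉ p

OnRight : ∀ a → Subset (a + b) → Set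
OnRight {b} a p = ∀ i → i ↑ˡ b ∉ p

leftHalf : ∀ a → Subset (a + b) → Subset (a + b)
leftHalf {b} a p = p ∩ (⊤ {a} ++ ⊥ {b})

rightHalf : ∀ a → Subset (a + b) → Subset (a + b)
rightHalf {b} a p = p ∩ (⊥ {a} ++ ⊤ {b})

module _ (p : Subset (a + b)) where

  leftHalf⊆ : leftHalf a p ⊆ p
  leftHalf⊆ = p∩q⊆p p _

  rightHalf⊆ : rightHalf a p ⊆ p
  rightHalf⊆ = p∩q⊆p p _

  OnLeft-leftHalf : OnLeft a (leftHalf a p)
  OnLeft-leftHalf j k∈ = ∉⊥ (∈-++⁻ʳ {p = ⊤ {a}} (proj₂ (x∈p∩q⁻ p _ k∈)))

  OnRight-rightHalf : OnRight a (rightHalf a p)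
  OnRight-rightHalf i k∈ = ∉⊥ (∈-++⁻ˡ {q = ⊤ {b}} (proj₂ (x∈p∩q⁻ p _ k∈)))

  ⊆leftHalf∪rightHalf : p ⊆ leftHalf a p ∪ rightHalf a p
  ⊆leftHalf∪rightHalf {k} k∈ with side a b k
  ... | left i  = x∈p∪q⁺ (inj₁ (x∈p∩q⁺ (k∈ , ∈-++⁺ˡ ∈⊤)))
  ... | right j = x∈p∪q⁺ (inj₂ (x∈p∩q⁺ (k∈ , ∈-++⁺ʳ {p = ⊥ {a}} ∈⊤)))

module _ {p : Subset (a + b)} where

  ∈-take⁻ : ∀ {i} → i ↑ˡ b ∈ p → i ∈ take a p
  ∈-take⁻ i∈ = ∈-++⁻ˡ (subst (_ ∈_) (sym (take++drop≡id a p)) i∈)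

  ∈-take⁺ : ∀ {i} → i ∈ take a p → i ↑ˡ b ∈ p
  ∈-take⁺ i∈ = subst (_ ∈_) (take++drop≡id a p) (∈-++⁺ˡ i∈)

  ∈-drop⁻ : ∀ {j} → a ↑ʳ j ∈ p → j ∈ drop a p
  ∈-drop⁻ j∈ = ∈-++⁻ʳ {p = take a p} (subst (_ ∈_) (sym (take++drop≡id a p)) j∈)

  ∈-drop⁺ : ∀ {j} → j ∈ drop a p → a ↑ʳ j ∈ p
  ∈-drop⁺ j∈ = subst (_ ∈_) (take++drop≡id a p) (∈-++⁺ʳ {p = take a p} j∈)

  ∣p∣≡∣take∣+∣drop∣ : ∣ p ∣ ≡ ∣ take a p ∣ + ∣ drop a p ∣
  ∣p∣≡∣take∣+∣drop∣ = trans (cong ∣_∣ (sym (take++drop≡id a p))) (∣p++q∣≡∣p∣+∣q∣ (take a p) (drop a p))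

  OnLeft⇒∣take∣≡∣p∣ : OnLeft a p → ∣ take a p ∣ ≡ ∣ p ∣
  OnLeft⇒∣take∣≡∣p∣ onLeft = sym (begin
    ∣ p ∣                         ≡⟨ ∣p∣≡∣take∣+∣drop∣ ⟩
    ∣ take a p ∣ + ∣ drop a p ∣   ≡⟨ cong (λ q → ∣ take a p ∣ + ∣ q ∣) (Empty-unique λ (j , j∈) → onLeft j (∈-drop⁺ j∈)) ⟩
    ∣ take a p ∣ + ∣ ⊥ {b} ∣      ≡⟨ cong (∣ take a p ∣ +_) (∣⊥∣≡0 b) ⟩
    ∣ take a p ∣ + 0              ≡⟨ +-identityʳ _ ⟩
    ∣ take a p ∣                  ∎)
    where open ≡-Reasoning

  OnRight⇒∣drop∣≡∣p∣ : OnRight a p → ∣ drop a p ∣ ≡ ∣ p ∣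
  OnRight⇒∣drop∣≡∣p∣ onRight = sym (begin
    ∣ p ∣                         ≡⟨ ∣p∣≡∣take∣+∣drop∣ ⟩
    ∣ take a p ∣ + ∣ drop a p ∣   ≡⟨ cong (λ q → ∣ q ∣ + ∣ drop a p ∣) (Empty-unique λ (i , i∈) → onRight i (∈-take⁺ i∈)) ⟩
    ∣ ⊥ {a} ∣ + ∣ drop a p ∣      ≡⟨ cong (_+ ∣ drop a p ∣) (∣⊥∣≡0 a) ⟩
    ∣ drop a p ∣                  ∎)
    where open ≡-Reasoning

module _ (H : Graph n m) (A : Subset n) where

  ∈δ⁻ : ∀ {e} → e ∈ δ H A → proj₁ (H e) ∈ A ⊎ proj₂ (H e) ∈ A
  ∈δ⁻ {e} e∈ with proj₁ (H e) ∈? A | proj₂ (H e) ∈? A | ∈-tabulate⁻ e∈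
  ... | yes v∈  | _       | _ = inj₁ v∈
  ... | no _    | yes w∈  | _ = inj₂ w∈
  ... | no _    | no _    | ()

  ∈δ⁺ : ∀ {e} → proj₁ (H e) ∈ A ⊎ proj₂ (H e) ∈ A → e ∈ δ H A
  ∈δ⁺ {e} ends∈ = ∈-tabulate⁺ (ends∈⇒true ends∈)
    where
    ends∈⇒true : proj₁ (H e) ∈ A ⊎ proj₂ (H e) ∈ A → (⌊ proj₁ (H e) ∈? A ⌋ ∨ ⌊ proj₂ (H e) ∈? A ⌋) ≡ true
    ends∈⇒true ends∈ with proj₁ (H e) ∈? A | proj₂ (H e) ∈? A
    ... | yes _  | _      = refl
    ... | no _   | yes _  = refl
    ... | no v∉  | no w∉  = ⊥-elim ([ v∉ , w∉ ]′ ends∈)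

  Joins⇒∈δ : ∀ {e v w} → Joins H e v w → v ∈ A ⊎ w ∈ A → e ∈ δ H A
  Joins⇒∈δ (inj₁ refl) ends∈ = ∈δ⁺ ends∈
  Joins⇒∈δ (inj₂ refl) ends∈ = ∈δ⁺ (swap ends∈)

  ∈δ⇒Joins : ∀ {e v w} → Joins H e v w → e ∈ δ H A → v ∈ A ⊎ w ∈ A
  ∈δ⇒Joins (inj₁ refl) e∈ = ∈δ⁻ e∈
  ∈δ⇒Joins (inj₂ refl) e∈ = swap (∈δ⁻ e∈)

δ-mono : ∀ (H : Graph n m) {A A' : Subset n} → A ⊆ A' → δ H A ⊆ δ H A'
δ-mono H {A} {A'} A⊆A' e∈ = ∈δ⁺ H A' (map-⊎ A⊆A' A⊆A' (∈δ⁻ H A e∈))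

-- Edges are admitted by a predicate rather than a subset, so that conditions such as
-- "i ≢ e₁ and the image of i in G is not deleted" need no subset construction.
data Path (G : Graph n m) (P : Fin m → Set) (u : Fin n) : Fin n → Set where
  nil  : Path G P u u
  cons : ∀ {e v w} → P e → Joins G e v w → Path G P u v → Path G P u w

ConnectedBy : Graph n m → (Fin m → Set) → Set
ConnectedBy G P = ∀ u v → Path G P u v

ReachesEither : Graph n m → (Fin m → Set) → Fin n → Fin n → Set
ReachesEither G P v w = ∀ u → Path G P u v ⊎ Path G P u w

module _ {G : Graph n m} where

  Joins-sym : ∀ {e v w} → Joins G e v w → Joins G e w v
  Joins-sym (inj₁ eq) = inj₂ eq
  Joins-sym (inj₂ eq) = inj₁ eq

  Joins-endpoint : ∀ {e v w v' w'} → Joins G e v w → Joins G e v' w' → v ≡ v' ⊎ v ≡ w'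
  Joins-endpoint (inj₁ p) (inj₁ q) = inj₁ (proj₁ (,-injective (trans (sym p) q)))
  Joins-endpoint (inj₁ p) (inj₂ q) = inj₂ (proj₁ (,-injective (trans (sym p) q)))
  Joins-endpoint (inj₂ p) (inj₁ q) = inj₂ (proj₂ (,-injective (trans (sym p) q)))
  Joins-endpoint (inj₂ p) (inj₂ q) = inj₁ (proj₂ (,-injective (trans (sym p) q)))

  path-trans : ∀ {P u v w} → Path G P u v → Path G P v w → Path G P u w
  path-trans p nil = p
  path-trans p (cons pe j q) = cons pe j (path-trans p q)

  path-edge : ∀ {P e v w} → P e → Joins G e v w → Path G P v w
  path-edge pe j = cons pe j nil

  path-sym : ∀ {P u v} → Path G P u v → Path G P v u
  path-sym nil = nil
  path-sym (cons pe j p) = path-trans (path-edge pe (Joins-sym j)) (path-sym p)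

  path-map : ∀ {P Q : Fin m → Set} {u v} → (∀ {e} → P e → Q e) → Path G P u v → Path G Q u v
  path-map f nil = nil
  path-map f (cons pe j p) = cons (f pe) j (path-map f p)

  connected⇒reaches : ∀ {P v w} → ConnectedBy G P → ReachesEither G P v w
  connected⇒reaches {v = v} c u = inj₁ (c u v)

  path-via : ∀ {P} h → (∀ u → Path G P u h) → ConnectedBy G P
  path-via h to-h u v = path-trans (to-h u) (path-sym (to-h v))

  reaches-map : ∀ {P Q : Fin m → Set} {v w} → (∀ {e} → P e → Q e) →
    ReachesEither G P v w → ReachesEither G Q v w
  reaches-map f r u = map-⊎ (path-map f) (path-map f) (r u)

  reach⇒path : ∀ {X u v} → Reach G X u v → Path G (_∈ X) u v
  reach⇒path here = nil
  reach⇒path (fwd e∈X r) = cons e∈X (inj₁ refl) (reach⇒path r)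
  reach⇒path (bwd e∈X r) = cons e∈X (inj₂ refl) (reach⇒path r)

  path⇒reach : ∀ {X u v} → Path G (_∈ X) u v → Reach G X u v
  path⇒reach nil = here
  path⇒reach {X} {u} (cons e∈X (inj₁ eq) p) =
    subst (Reach G X u) (cong proj₂ eq)
      (fwd e∈X (subst (Reach G X u) (sym (cong proj₁ eq)) (path⇒reach p)))
  path⇒reach {X} {u} (cons e∈X (inj₂ eq) p) =
    subst (Reach G X u) (cong proj₁ eq)
      (bwd e∈X (subst (Reach G X u) (sym (cong proj₂ eq)) (path⇒reach p)))

  connected⇒bondIndep : ∀ F → ConnectedBy G (_∉ F) → BondIndep G F
  connected⇒bondIndep F c u v _ = path⇒reach (path-map x∉p⇒x∈∁p (c u v))

  bondIndep⇒connected : ConnectedBy G (λ _ → ⊤₀) → ∀ F → BondIndep G F → ConnectedBy G (_∉ F)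
  bondIndep⇒connected c F bi u v =
    path-map x∈∁p⇒x∉p (reach⇒path (bi u v (path⇒reach (path-map (λ _ → ∈⊤) (c u v)))))

  Connected⇒ConnectedBy : Connected G → ConnectedBy G (λ _ → ⊤₀)
  Connected⇒ConnectedBy c u v = path-map (λ _ → tt) (reach⇒path (c u v))

  allBut-connected : ∀ {e} → (∀ u v → Reach G (allBut e) u v) → ConnectedBy G (_≢ e)
  allBut-connected c u v = path-map ∈allBut⁻ (reach⇒path (c u v))

RankAtLeast : Graph n m → Subset n → ℕ → Set
RankAtLeast {m = m} H A k = Σ (Subset m) λ F → F ⊆ δ H A × BondIndep H F × k ≤ ∣ F ∣

Dep⇒rank≤ : ∀ {H : Graph n m} {A k} → Dep H A → RankAtLeast H A k → k ≤ ∣ A ∣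
Dep⇒rank≤ dep (F , F⊆ , bi , k≤) = ≤-trans k≤ (dep F F⊆ bi)

¬rank>⇒Dep : ∀ {H : Graph n m} {A} → ¬ RankAtLeast H A (suc ∣ A ∣) → Dep H A
¬rank>⇒Dep {A = A} ¬rank> F F⊆ bi with ∣ F ∣ ≤? ∣ A ∣
... | yes ≤∣A∣ = ≤∣A∣
... | no  ≰∣A∣ = ⊥-elim (¬rank> (F , F⊆ , bi , ≰⇒> ≰∣A∣))

record Switch {n₁ n₂ m₁ m₂} (G₁ : Graph n₁ m₁) (G₂ : Graph n₂ m₂) : Set where
  field
    e₁    : Fin m₁
    a₁ b₁ : Fin n₁
    joins-e₁    : Joins G₁ e₁ a₁ b₁
    e₂    : Fin m₂
    a₂ b₂ : Fin n₂
    joins-e₂    : Joins G₂ e₂ a₂ b₂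

  graph : Graph (n₁ + n₂) (m₁ + m₂)
  graph = twoSwitch G₁ G₂ e₁ a₁ b₁ e₂ a₂ b₂

OneSided : ∀ a → Subset (a + b) → Set
OneSided a p = OnLeft a p ⊎ OnRight a p

OneSided-⊆ : ∀ {p q : Subset (a + b)} → q ⊆ p → OneSided a p → OneSided a q
OneSided-⊆ q⊆p (inj₁ onLeft)  = inj₁ λ j k∈ → onLeft j (q⊆p k∈)
OneSided-⊆ q⊆p (inj₂ onRight) = inj₂ λ i k∈ → onRight i (q⊆p k∈)

SideDep : ∀ {n₁ n₂ m₁ m₂} → Graph n₁ m₁ → Graph n₂ m₂ → (B : Subset (n₁ + n₂)) → OneSided n₁ B → Set
SideDep {n₁} G₁ G₂ B (inj₁ _) = Dep G₁ (take n₁ B)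
SideDep {n₁} G₁ G₂ B (inj₂ _) = Dep G₂ (drop n₁ B)

module TwoSwitch {n₁ n₂ m₁ m₂} {G₁ : Graph n₁ m₁} {G₂ : Graph n₂ m₂}
  (tec₁ : TwoEdgeConnected G₁) (tec₂ : TwoEdgeConnected G₂) (s : Switch G₁ G₂) where

  open Switch s

  G : Graph (n₁ + n₂) (m₁ + m₂)
  G = graph

  ι₁ : Fin n₁ → Fin (n₁ + n₂)
  ι₁ = inl n₂

  ι₂ : Fin n₂ → Fin (n₁ + n₂)
  ι₂ = inr n₁

  xa : Fin (m₁ + m₂)
  xa = e₁ ↑ˡ m₂

  xb : Fin (m₁ + m₂)
  xb = m₁ ↑ʳ e₂

  G-left : ∀ i → i ≢ e₁ → G (i ↑ˡ m₂) ≡ (ι₁ (proj₁ (G₁ i)) , ι₁ (proj₂ (G₁ i)))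
  G-left i i≢e₁ rewrite splitAt-↑ˡ m₁ i m₂ with i ≟ e₁
  ... | yes i≡e₁ = ⊥-elim (i≢e₁ i≡e₁)
  ... | no _     = refl

  G-right : ∀ j → j ≢ e₂ → G (m₁ ↑ʳ j) ≡ (ι₂ (proj₁ (G₂ j)) , ι₂ (proj₂ (G₂ j)))
  G-right j j≢e₂ rewrite splitAt-↑ʳ m₁ m₂ j with j ≟ e₂
  ... | yes j≡e₂ = ⊥-elim (j≢e₂ j≡e₂)
  ... | no _     = refl

  G-xa : G xa ≡ (ι₁ a₁ , ι₂ a₂)
  G-xa rewrite splitAt-↑ˡ m₁ e₁ m₂ with e₁ ≟ e₁
  ... | yes _    = refl
  ... | no e₁≢e₁ = ⊥-elim (e₁≢e₁ refl)

  G-xb : G xb ≡ (ι₁ b₁ , ι₂ b₂)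
  G-xb rewrite splitAt-↑ʳ m₁ m₂ e₂ with e₂ ≟ e₂
  ... | yes _    = refl
  ... | no e₂≢e₂ = ⊥-elim (e₂≢e₂ refl)

  joins-xa : Joins G xa (ι₁ a₁) (ι₂ a₂)
  joins-xa = inj₁ G-xa

  joins-xb : Joins G xb (ι₁ b₁) (ι₂ b₂)
  joins-xb = inj₁ G-xb

  joins-left : ∀ {i v w} → i ≢ e₁ → Joins G₁ i v w → Joins G (i ↑ˡ m₂) (ι₁ v) (ι₁ w)
  joins-left {i} i≢e₁ = map-⊎ (embed-ends (G-left i i≢e₁)) (embed-ends (G-left i i≢e₁))
    where
    embed-ends : ∀ {x y} → G (i ↑ˡ m₂) ≡ (ι₁ (proj₁ (G₁ i)) , ι₁ (proj₂ (G₁ i))) →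
      G₁ i ≡ (x , y) → G (i ↑ˡ m₂) ≡ (ι₁ x , ι₁ y)
    embed-ends eq refl = eq

  joins-right : ∀ {j v w} → j ≢ e₂ → Joins G₂ j v w → Joins G (m₁ ↑ʳ j) (ι₂ v) (ι₂ w)
  joins-right {j} j≢e₂ = map-⊎ (embed-ends (G-right j j≢e₂)) (embed-ends (G-right j j≢e₂))
    where
    embed-ends : ∀ {x y} → G (m₁ ↑ʳ j) ≡ (ι₂ (proj₁ (G₂ j)) , ι₂ (proj₂ (G₂ j))) →
      G₂ j ≡ (x , y) → G (m₁ ↑ʳ j) ≡ (ι₂ x , ι₂ y)
    embed-ends eq refl = eq

  lift-left : ∀ {i v w} → i ≢ e₁ → Joins G (i ↑ˡ m₂) (ι₁ v) w → Σ (Fin n₁) λ w' → w ≡ ι₁ w' × Joins G₁ i v w'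
  lift-left {i} i≢e₁ (inj₁ eq) with ,-injective (trans (sym eq) (G-left i i≢e₁))
  ... | p , q = proj₂ (G₁ i) , q , inj₁ (cong (_, proj₂ (G₁ i)) (sym (↑ˡ-inj p)))
  lift-left {i} i≢e₁ (inj₂ eq) with ,-injective (trans (sym eq) (G-left i i≢e₁))
  ... | p , q = proj₁ (G₁ i) , p , inj₂ (cong (proj₁ (G₁ i) ,_) (sym (↑ˡ-inj q)))

  lift-right : ∀ {j v w} → j ≢ e₂ → Joins G (m₁ ↑ʳ j) (ι₂ v) w → Σ (Fin n₂) λ w' → w ≡ ι₂ w' × Joins G₂ j v w'
  lift-right {j} j≢e₂ (inj₁ eq) with ,-injective (trans (sym eq) (G-right j j≢e₂))
  ... | p , q = proj₂ (G₂ j) , q , inj₁ (cong (_, proj₂ (G₂ j)) (sym (↑ʳ-inj p)))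
  lift-right {j} j≢e₂ (inj₂ eq) with ,-injective (trans (sym eq) (G-right j j≢e₂))
  ... | p , q = proj₁ (G₂ j) , p , inj₂ (cong (proj₁ (G₂ j) ,_) (sym (↑ʳ-inj q)))

  right-misses-left : ∀ {j v w} → j ≢ e₂ → Joins G (m₁ ↑ʳ j) (ι₁ v) w → ⊥₀
  right-misses-left {j} j≢e₂ (inj₁ eq) = ↑ˡ≢↑ʳ (proj₁ (,-injective (trans (sym eq) (G-right j j≢e₂))))
  right-misses-left {j} j≢e₂ (inj₂ eq) = ↑ˡ≢↑ʳ (proj₂ (,-injective (trans (sym eq) (G-right j j≢e₂))))

  left-misses-right : ∀ {i v w} → i ≢ e₁ → Joins G (i ↑ˡ m₂) (ι₂ v) w → ⊥₀
  left-misses-right {i} i≢e₁ (inj₁ eq) = ↑ˡ≢↑ʳ (sym (proj₁ (,-injective (trans (sym eq) (G-left i i≢e₁)))))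
  left-misses-right {i} i≢e₁ (inj₂ eq) = ↑ˡ≢↑ʳ (sym (proj₂ (,-injective (trans (sym eq) (G-left i i≢e₁)))))

  xa-at-left : ∀ {v w} → Joins G xa (ι₁ v) w → v ≡ a₁
  xa-at-left (inj₁ eq) = ↑ˡ-inj (proj₁ (,-injective (trans (sym eq) G-xa)))
  xa-at-left (inj₂ eq) = ⊥-elim (↑ˡ≢↑ʳ (proj₂ (,-injective (trans (sym eq) G-xa))))

  xa-at-right : ∀ {v w} → Joins G xa (ι₂ v) w → v ≡ a₂
  xa-at-right (inj₁ eq) = ⊥-elim (↑ˡ≢↑ʳ (sym (proj₁ (,-injective (trans (sym eq) G-xa)))))
  xa-at-right (inj₂ eq) = ↑ʳ-inj (proj₂ (,-injective (trans (sym eq) G-xa)))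

  xb-at-left : ∀ {v w} → Joins G xb (ι₁ v) w → v ≡ b₁
  xb-at-left (inj₁ eq) = ↑ˡ-inj (proj₁ (,-injective (trans (sym eq) G-xb)))
  xb-at-left (inj₂ eq) = ⊥-elim (↑ˡ≢↑ʳ (proj₂ (,-injective (trans (sym eq) G-xb))))

  xb-at-right : ∀ {v w} → Joins G xb (ι₂ v) w → v ≡ b₂
  xb-at-right (inj₁ eq) = ⊥-elim (↑ˡ≢↑ʳ (sym (proj₁ (,-injective (trans (sym eq) G-xb)))))
  xb-at-right (inj₂ eq) = ↑ʳ-inj (proj₂ (,-injective (trans (sym eq) G-xb)))

  Restrict₁ : (Fin (m₁ + m₂) → Set) → Fin m₁ → Set
  Restrict₁ P i = i ≢ e₁ × P (i ↑ˡ m₂)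
  Restrict₂ : (Fin (m₁ + m₂) → Set) → Fin m₂ → Set
  Restrict₂ P j = j ≢ e₂ × P (m₁ ↑ʳ j)

  embed₁ : ∀ {P u v} → Path G₁ (Restrict₁ P) u v → Path G P (ι₁ u) (ι₁ v)
  embed₁ nil                     = nil
  embed₁ (cons (i≢e₁ , pe) j p) = cons pe (joins-left i≢e₁ j) (embed₁ p)

  embed₂ : ∀ {P u v} → Path G₂ (Restrict₂ P) u v → Path G P (ι₂ u) (ι₂ v)
  embed₂ nil                     = nil
  embed₂ (cons (j≢e₂ , pe) j p) = cons pe (joins-right j≢e₂ j) (embed₂ p)

  project₁ : ∀ {P u w} → Path G P (ι₁ u) w →
    (Σ (Fin n₁) λ w' → w ≡ ι₁ w' × Path G₁ (Restrict₁ P) u w') ⊎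
    (P xa × Path G₁ (Restrict₁ P) u a₁) ⊎ (P xb × Path G₁ (Restrict₁ P) u b₁)
  project₁ nil = inj₁ (_ , refl , nil)
  project₁ {P} (cons {e} pe je p) with project₁ p
  ... | inj₂ left-V₁ = inj₂ left-V₁
  ... | inj₁ (v , refl , u→v) = step e (side m₁ m₂ e) pe je
    where
    step : ∀ {w} e → Side m₁ m₂ e → P e → Joins G e (ι₁ v) w → _
    step .(i ↑ˡ m₂) (left i) pe je with i ≟ e₁
    ... | no i≢e₁ = let (w , w≡ , je₁) = lift-left i≢e₁ je in inj₁ (w , w≡ , cons (i≢e₁ , pe) je₁ u→v)
    ... | yes refl = inj₂ (inj₁ (pe , subst (Path G₁ (Restrict₁ P) _) (xa-at-left je) u→v))
    step .(m₁ ↑ʳ j) (right j) pe je with j ≟ e₂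
    ... | no j≢e₂ = ⊥-elim (right-misses-left j≢e₂ je)
    ... | yes refl = inj₂ (inj₂ (pe , subst (Path G₁ (Restrict₁ P) _) (xb-at-left je) u→v))

  project₂ : ∀ {P u w} → Path G P (ι₂ u) w →
    (Σ (Fin n₂) λ w' → w ≡ ι₂ w' × Path G₂ (Restrict₂ P) u w') ⊎
    (P xa × Path G₂ (Restrict₂ P) u a₂) ⊎ (P xb × Path G₂ (Restrict₂ P) u b₂)
  project₂ nil = inj₁ (_ , refl , nil)
  project₂ {P} (cons {e} pe je p) with project₂ p
  ... | inj₂ left-V₂ = inj₂ left-V₂
  ... | inj₁ (v , refl , u→v) = step e (side m₁ m₂ e) pe je
    where
    step : ∀ {w} e → Side m₁ m₂ e → P e → Joins G e (ι₂ v) w → _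
    step .(m₁ ↑ʳ j) (right j) pe je with j ≟ e₂
    ... | no j≢e₂ = let (w , w≡ , je₂) = lift-right j≢e₂ je in inj₁ (w , w≡ , cons (j≢e₂ , pe) je₂ u→v)
    ... | yes refl = inj₂ (inj₂ (pe , subst (Path G₂ (Restrict₂ P) _) (xb-at-right je) u→v))
    step .(i ↑ˡ m₂) (left i) pe je with i ≟ e₁
    ... | no i≢e₁ = ⊥-elim (left-misses-right i≢e₁ je)
    ... | yes refl = inj₂ (inj₁ (pe , subst (Path G₂ (Restrict₂ P) _) (xa-at-right je) u→v))

  module _ {P : Fin (m₁ + m₂) → Set} where

    connected-via-a₁ : ReachesEither G₁ (Restrict₁ P) a₁ b₁ → ReachesEither G₂ (Restrict₂ P) a₂ b₂ →
      Path G P (ι₁ b₁) (ι₁ a₁) → Path G P (ι₂ a₂) (ι₁ a₁) → Path G P (ι₂ b₂) (ι₁ a₁) →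
      ConnectedBy G P
    connected-via-a₁ reach₁ reach₂ b₁→a₁ a₂→a₁ b₂→a₁ = path-via (ι₁ a₁) to-a₁
      where
      to-a₁ : ∀ v → Path G P v (ι₁ a₁)
      to-a₁ v with side n₁ n₂ v
      ... | left u with reach₁ u
      ...   | inj₁ p = embed₁ p
      ...   | inj₂ p = path-trans (embed₁ p) b₁→a₁
      to-a₁ v | right u with reach₂ u
      ...   | inj₁ p = path-trans (embed₂ p) a₂→a₁
      ...   | inj₂ p = path-trans (embed₂ p) b₂→a₁

    connected-via-both : P xa → P xb →
      ReachesEither G₁ (Restrict₁ P) a₁ b₁ → ReachesEither G₂ (Restrict₂ P) a₂ b₂ →
      Path G₁ (Restrict₁ P) a₁ b₁ ⊎ Path G₂ (Restrict₂ P) a₂ b₂ → ConnectedBy G P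
    connected-via-both pxa pxb reach₁ reach₂ (inj₁ a₁→b₁) =
      connected-via-a₁ reach₁ reach₂ b₁→a₁ a₂→a₁ (path-trans (path-edge pxb (Joins-sym {G = G} joins-xb)) b₁→a₁)
      where b₁→a₁ = path-sym (embed₁ a₁→b₁)
            a₂→a₁ = path-edge pxa (Joins-sym {G = G} joins-xa)
    connected-via-both pxa pxb reach₁ reach₂ (inj₂ a₂→b₂) =
      connected-via-a₁ reach₁ reach₂ (path-trans (path-edge pxb joins-xb) b₂→a₁) a₂→a₁ b₂→a₁
      where a₂→a₁ = path-edge pxa (Joins-sym {G = G} joins-xa)
            b₂→a₁ = path-trans (path-sym (embed₂ a₂→b₂)) a₂→a₁

    connected-via-xa : P xa → ConnectedBy G₁ (Restrict₁ P) → ConnectedBy G₂ (Restrict₂ P) → ConnectedBy G P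
    connected-via-xa pxa c₁ c₂ =
      connected-via-a₁ (λ u → inj₁ (c₁ u a₁)) (λ u → inj₁ (c₂ u a₂))
        (embed₁ (c₁ b₁ a₁)) a₂→a₁ (path-trans (embed₂ (c₂ b₂ a₂)) a₂→a₁)
      where a₂→a₁ = path-edge pxa (Joins-sym {G = G} joins-xa)

    connected-via-xb : P xb → ConnectedBy G₁ (Restrict₁ P) → ConnectedBy G₂ (Restrict₂ P) → ConnectedBy G P
    connected-via-xb pxb c₁ c₂ =
      connected-via-a₁ (λ u → inj₁ (c₁ u a₁)) (λ u → inj₁ (c₂ u a₂))
        b₁→a₁ (path-trans (embed₂ (c₂ a₂ b₂)) b₂→a₁) b₂→a₁
      where b₁→a₁ = embed₁ (c₁ b₁ a₁)
            b₂→a₁ = path-trans (path-edge pxb (Joins-sym {G = G} joins-xb)) b₁→a₁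

  G₁-e₁-connected : ConnectedBy G₁ (_≢ e₁)
  G₁-e₁-connected = allBut-connected (proj₂ tec₁ e₁)

  G₂-e₂-connected : ConnectedBy G₂ (_≢ e₂)
  G₂-e₂-connected = allBut-connected (proj₂ tec₂ e₂)

  G₁-connected : ConnectedBy G₁ (λ _ → ⊤₀)
  G₁-connected = Connected⇒ConnectedBy (proj₁ tec₁)

  G₂-connected : ConnectedBy G₂ (λ _ → ⊤₀)
  G₂-connected = Connected⇒ConnectedBy (proj₁ tec₂)

  G-connected : ConnectedBy G (λ _ → ⊤₀)
  G-connected = connected-via-both tt tt
    (λ u → inj₁ (path-map (_, tt) (G₁-e₁-connected u a₁)))
    (λ u → inj₁ (path-map (_, tt) (G₂-e₂-connected u a₂)))
    (inj₁ (path-map (_, tt) (G₁-e₁-connected a₁ b₁)))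

  avoid-e₁ : ∀ {Q : Fin m₁ → Set} {u w} → Path G₁ Q u w →
    let Q' = λ i → i ≢ e₁ × Q i in Path G₁ Q' u w ⊎ Path G₁ Q' u a₁ ⊎ Path G₁ Q' u b₁
  avoid-e₁ nil = inj₁ nil
  avoid-e₁ (cons {e} q jn p) with avoid-e₁ p
  ... | inj₂ r = inj₂ r
  ... | inj₁ r with e ≟ e₁
  ...   | no e≢e₁ = inj₁ (cons (e≢e₁ , q) jn r)
  ...   | yes refl with Joins-endpoint {G = G₁} jn joins-e₁
  ...     | inj₁ refl = inj₂ (inj₁ r)
  ...     | inj₂ refl = inj₂ (inj₂ r)

  avoid-e₂ : ∀ {Q : Fin m₂ → Set} {u w} → Path G₂ Q u w →
    let Q' = λ j → j ≢ e₂ × Q j in Path G₂ Q' u w ⊎ Path G₂ Q' u a₂ ⊎ Path G₂ Q' u b₂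
  avoid-e₂ nil = inj₁ nil
  avoid-e₂ (cons {e} q jn p) with avoid-e₂ p
  ... | inj₂ r = inj₂ r
  ... | inj₁ r with e ≟ e₂
  ...   | no e≢e₂ = inj₁ (cons (e≢e₂ , q) jn r)
  ...   | yes refl with Joins-endpoint {G = G₂} jn joins-e₂
  ...     | inj₁ refl = inj₂ (inj₁ r)
  ...     | inj₂ refl = inj₂ (inj₂ r)

  reaches-end₁ : ∀ {Q : Fin m₁ → Set} → (∀ u → Path G₁ Q u a₁) → ReachesEither G₁ (λ i → i ≢ e₁ × Q i) a₁ b₁
  reaches-end₁ to-a₁ u with avoid-e₁ (to-a₁ u)
  ... | inj₁ p = inj₁ p
  ... | inj₂ r = r

  reaches-end₂ : ∀ {Q : Fin m₂ → Set} → (∀ u → Path G₂ Q u a₂) → ReachesEither G₂ (λ j → j ≢ e₂ × Q j) a₂ b₂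
  reaches-end₂ to-a₂ u with avoid-e₂ (to-a₂ u)
  ... | inj₁ p = inj₁ p
  ... | inj₂ r = r

  crossing₁ : ∀ {P} → ConnectedBy G P → ∀ u →
    (P xa × Path G₁ (Restrict₁ P) u a₁) ⊎ (P xb × Path G₁ (Restrict₁ P) u b₁)
  crossing₁ c u with project₁ (c (ι₁ u) (ι₂ a₂))
  ... | inj₁ (_ , eq , _) = ⊥-elim (↑ˡ≢↑ʳ (sym eq))
  ... | inj₂ r = r

  crossing₂ : ∀ {P} → ConnectedBy G P → ∀ u →
    (P xa × Path G₂ (Restrict₂ P) u a₂) ⊎ (P xb × Path G₂ (Restrict₂ P) u b₂)
  crossing₂ c u with project₂ (c (ι₂ u) (ι₁ a₁))
  ... | inj₁ (_ , eq , _) = ⊥-elim (↑ˡ≢↑ʳ eq)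
  ... | inj₂ r = r

  e₁↦xb : Fin m₁ → Fin (m₁ + m₂)
  e₁↦xb i with i ≟ e₁
  ... | yes _ = xb
  ... | no _  = i ↑ˡ m₂

  e₁↦xb-injective : ∀ {i i'} → e₁↦xb i ≡ e₁↦xb i' → i ≡ i'
  e₁↦xb-injective {i} {i'} with i ≟ e₁ | i' ≟ e₁
  ... | yes p | yes q = λ _ → trans p (sym q)
  ... | yes _ | no _  = λ eq → ⊥-elim (↑ˡ≢↑ʳ (sym eq))
  ... | no _  | yes _ = λ eq → ⊥-elim (↑ˡ≢↑ʳ eq)
  ... | no _  | no _  = ↑ˡ-inj

  e₂↦xa : Fin m₂ → Fin (m₁ + m₂)
  e₂↦xa j with j ≟ e₂
  ... | yes _ = xa
  ... | no _  = m₁ ↑ʳ j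

  e₂↦xa-injective : ∀ {j j'} → e₂↦xa j ≡ e₂↦xa j' → j ≡ j'
  e₂↦xa-injective {j} {j'} with j ≟ e₂ | j' ≟ e₂
  ... | yes p | yes q = λ _ → trans p (sym q)
  ... | yes _ | no _  = λ eq → ⊥-elim (↑ˡ≢↑ʳ eq)
  ... | no _  | yes _ = λ eq → ⊥-elim (↑ˡ≢↑ʳ (sym eq))
  ... | no _  | no _  = ↑ʳ-inj

  δ-left : ∀ B {i} → i ≢ e₁ → i ∈ δ G₁ (take n₁ B) → i ↑ˡ m₂ ∈ δ G B
  δ-left B {i} i≢e₁ i∈ = Joins⇒∈δ G B (joins-left i≢e₁ (inj₁ refl))
    (map-⊎ ∈-take⁺ ∈-take⁺ (∈δ⇒Joins G₁ (take n₁ B) (inj₁ refl) i∈))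

  δ-right : ∀ B {j} → j ≢ e₂ → j ∈ δ G₂ (drop n₁ B) → m₁ ↑ʳ j ∈ δ G B
  δ-right B {j} j≢e₂ j∈ = Joins⇒∈δ G B (joins-right j≢e₂ (inj₁ refl))
    (map-⊎ ∈-drop⁺ ∈-drop⁺ (∈δ⇒Joins G₂ (drop n₁ B) (inj₁ refl) j∈))

  module _ (B : Subset (n₁ + n₂)) (F₁ : Subset m₁) (F₁⊆ : F₁ ⊆ δ G₁ (take n₁ B)) (bi : BondIndep G₁ F₁) where

    private
      c₁ : ConnectedBy G₁ (_∉ F₁)
      c₁ = bondIndep⇒connected G₁-connected F₁ bi

      F : Subset (m₁ + m₂)
      F = F₁ ++ ⊥

      right∉F : ∀ {j} → m₁ ↑ʳ j ∉ F
      right∉F k∈ = ∉⊥ (∈-++⁻ʳ {p = F₁} k∈)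

      left∉F : ∀ {i} → i ∉ F₁ → i ↑ˡ m₂ ∉ F
      left∉F i∉ k∈ = i∉ (∈-++⁻ˡ k∈)

      keep₂ : ∀ {j} → j ≢ e₂ → Restrict₂ (_∉ F) j
      keep₂ j≢e₂ = j≢e₂ , right∉F

      keep₁ : e₁ ∈ F₁ → ∀ {i} → i ∉ F₁ → Restrict₁ (_∉ F) i
      keep₁ e₁∈ i∉ = (λ { refl → i∉ e₁∈ }) , left∉F i∉

      ∣F₁∣≤∣F∣ : ∣ F₁ ∣ ≤ ∣ F ∣
      ∣F₁∣≤∣F∣ = injection⇒∣p∣≤∣q∣ F₁ F (_↑ˡ m₂) ∈-++⁺ˡ (λ _ _ → ↑ˡ-inj)

    lift₁-avoiding-e₁ : e₁ ∉ F₁ → RankAtLeast G B ∣ F₁ ∣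
    lift₁-avoiding-e₁ e₁∉ = F , F⊆ , connected⇒bondIndep F connected , ∣F₁∣≤∣F∣
      where
      F⊆ : F ⊆ δ G B
      F⊆ {k} k∈ with side m₁ m₂ k
      ... | left i  = δ-left B (λ { refl → e₁∉ (∈-++⁻ˡ k∈) }) (F₁⊆ (∈-++⁻ˡ k∈))
      ... | right j = ⊥-elim (right∉F k∈)
      connected : ConnectedBy G (_∉ F)
      connected = connected-via-both (left∉F e₁∉) right∉F
        (reaches-map (λ (i≢e₁ , i∉) → i≢e₁ , left∉F i∉) (reaches-end₁ (λ u → c₁ u a₁)))
        (λ u → inj₁ (path-map keep₂ (G₂-e₂-connected u a₂)))
        (inj₂ (path-map keep₂ (G₂-e₂-connected a₂ b₂)))

    lift₁-e₁-as-xa : e₁ ∈ F₁ → a₁ ∈ take n₁ B → RankAtLeast G B ∣ F₁ ∣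
    lift₁-e₁-as-xa e₁∈ a₁∈ = F , F⊆ , connected⇒bondIndep F connected , ∣F₁∣≤∣F∣
      where
      F⊆ : F ⊆ δ G B
      F⊆ {k} k∈ with side m₁ m₂ k
      ... | right j = ⊥-elim (right∉F k∈)
      ... | left i with i ≟ e₁
      ...   | yes refl  = Joins⇒∈δ G B joins-xa (inj₁ (∈-take⁺ a₁∈))
      ...   | no i≢e₁   = δ-left B i≢e₁ (F₁⊆ (∈-++⁻ˡ k∈))
      connected : ConnectedBy G (_∉ F)
      connected = connected-via-xb right∉F
        (λ u v → path-map (keep₁ e₁∈) (c₁ u v))
        (λ u v → path-map keep₂ (G₂-e₂-connected u v))

    lift₁-e₁-as-xb : e₁ ∈ F₁ → a₁ ∉ take n₁ B → RankAtLeast G B ∣ F₁ ∣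
    lift₁-e₁-as-xb e₁∈ a₁∉ = F' , F'⊆ , connected⇒bondIndep F' connected ,
      injection⇒∣p∣≤∣q∣ F₁ F' e₁↦xb maps (λ _ _ → e₁↦xb-injective)
      where
      F' : Subset (m₁ + m₂)
      F' = (F₁ - e₁) ++ ⁅ e₂ ⁆
      b₁∈ : b₁ ∈ take n₁ B
      b₁∈ = [ (λ a₁∈ → ⊥-elim (a₁∉ a₁∈)) , (λ b₁∈ → b₁∈) ]′ (∈δ⇒Joins G₁ (take n₁ B) joins-e₁ (F₁⊆ e₁∈))
      F'⊆ : F' ⊆ δ G B
      F'⊆ {k} k∈ with side m₁ m₂ k
      ... | left i with x∈p-y⁻ (∈-++⁻ˡ k∈)
      ...   | i∈ , i≢e₁ = δ-left B i≢e₁ (F₁⊆ i∈)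
      F'⊆ {k} k∈ | right j with x∈⁅y⁆⇒x≡y e₂ (∈-++⁻ʳ {p = F₁ - e₁} k∈)
      ...   | refl = Joins⇒∈δ G B joins-xb (inj₁ (∈-take⁺ b₁∈))
      keep₁' : ∀ {i} → i ∉ F₁ → Restrict₁ (_∉ F') i
      keep₁' i∉ = (λ { refl → i∉ e₁∈ }) , λ k∈ → i∉ (proj₁ (x∈p-y⁻ {p = F₁} (∈-++⁻ˡ k∈)))
      keep₂' : ∀ {j} → j ≢ e₂ → Restrict₂ (_∉ F') j
      keep₂' j≢e₂ = j≢e₂ , λ k∈ → j≢e₂ (x∈⁅y⁆⇒x≡y e₂ (∈-++⁻ʳ {p = F₁ - e₁} k∈))
      connected : ConnectedBy G (_∉ F')
      connected = connected-via-xa (λ xa∈ → proj₂ (x∈p-y⁻ {p = F₁} (∈-++⁻ˡ xa∈)) refl)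
        (λ u v → path-map keep₁' (c₁ u v)) (λ u v → path-map keep₂' (G₂-e₂-connected u v))
      maps : ∀ {i} → i ∈ F₁ → e₁↦xb i ∈ F'
      maps {i} i∈ with i ≟ e₁
      ... | yes _    = ∈-++⁺ʳ {p = F₁ - e₁} (x∈⁅x⁆ e₂)
      ... | no i≢e₁  = ∈-++⁺ˡ (x∈p∧x≢y⇒x∈p-y i∈ i≢e₁)

    lift₁ : RankAtLeast G B ∣ F₁ ∣
    lift₁ with e₁ ∈? F₁ | a₁ ∈? take n₁ B
    ... | no e₁∉  | _        = lift₁-avoiding-e₁ e₁∉
    ... | yes e₁∈ | yes a₁∈  = lift₁-e₁-as-xa e₁∈ a₁∈
    ... | yes e₁∈ | no a₁∉   = lift₁-e₁-as-xb e₁∈ a₁∉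

  dep⇒dep₁ : ∀ B → OnLeft n₁ B → Dep G B → Dep G₁ (take n₁ B)
  dep⇒dep₁ B onLeft dep F₁ F₁⊆ bi =
    ≤-trans (Dep⇒rank≤ dep (lift₁ B F₁ F₁⊆ bi)) (≤-reflexive (sym (OnLeft⇒∣take∣≡∣p∣ onLeft)))

  module _ (B : Subset (n₁ + n₂)) (F₂ : Subset m₂) (F₂⊆ : F₂ ⊆ δ G₂ (drop n₁ B)) (bi : BondIndep G₂ F₂) where

    private
      c₂ : ConnectedBy G₂ (_∉ F₂)
      c₂ = bondIndep⇒connected G₂-connected F₂ bi

      F : Subset (m₁ + m₂)
      F = ⊥ ++ F₂

      left∉F : ∀ {i} → i ↑ˡ m₂ ∉ F
      left∉F k∈ = ∉⊥ (∈-++⁻ˡ {q = F₂} k∈)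

      right∉F : ∀ {j} → j ∉ F₂ → m₁ ↑ʳ j ∉ F
      right∉F j∉ k∈ = j∉ (∈-++⁻ʳ {p = ⊥} k∈)

      keep₁ : ∀ {i} → i ≢ e₁ → Restrict₁ (_∉ F) i
      keep₁ i≢e₁ = i≢e₁ , left∉F

      keep₂ : e₂ ∈ F₂ → ∀ {j} → j ∉ F₂ → Restrict₂ (_∉ F) j
      keep₂ e₂∈ j∉ = (λ { refl → j∉ e₂∈ }) , right∉F j∉

      ∣F₂∣≤∣F∣ : ∣ F₂ ∣ ≤ ∣ F ∣
      ∣F₂∣≤∣F∣ = injection⇒∣p∣≤∣q∣ F₂ F (m₁ ↑ʳ_) (∈-++⁺ʳ {p = ⊥}) (λ _ _ → ↑ʳ-inj)

    lift₂-avoiding-e₂ : e₂ ∉ F₂ → RankAtLeast G B ∣ F₂ ∣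
    lift₂-avoiding-e₂ e₂∉ = F , F⊆ , connected⇒bondIndep F connected , ∣F₂∣≤∣F∣
      where
      F⊆ : F ⊆ δ G B
      F⊆ {k} k∈ with side m₁ m₂ k
      ... | right j = δ-right B (λ { refl → e₂∉ (∈-++⁻ʳ {p = ⊥} k∈) }) (F₂⊆ (∈-++⁻ʳ {p = ⊥} k∈))
      ... | left i  = ⊥-elim (left∉F k∈)
      connected : ConnectedBy G (_∉ F)
      connected = connected-via-both left∉F (right∉F e₂∉)
        (λ u → inj₁ (path-map keep₁ (G₁-e₁-connected u a₁)))
        (reaches-map (λ (j≢e₂ , j∉) → j≢e₂ , right∉F j∉) (reaches-end₂ (λ u → c₂ u a₂)))
        (inj₁ (path-map keep₁ (G₁-e₁-connected a₁ b₁)))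

    lift₂-e₂-as-xb : e₂ ∈ F₂ → b₂ ∈ drop n₁ B → RankAtLeast G B ∣ F₂ ∣
    lift₂-e₂-as-xb e₂∈ b₂∈ = F , F⊆ , connected⇒bondIndep F connected , ∣F₂∣≤∣F∣
      where
      F⊆ : F ⊆ δ G B
      F⊆ {k} k∈ with side m₁ m₂ k
      ... | left i = ⊥-elim (left∉F k∈)
      ... | right j with j ≟ e₂
      ...   | yes refl  = Joins⇒∈δ G B joins-xb (inj₂ (∈-drop⁺ b₂∈))
      ...   | no j≢e₂   = δ-right B j≢e₂ (F₂⊆ (∈-++⁻ʳ {p = ⊥} k∈))
      connected : ConnectedBy G (_∉ F)
      connected = connected-via-xa left∉F
        (λ u v → path-map keep₁ (G₁-e₁-connected u v))
        (λ u v → path-map (keep₂ e₂∈) (c₂ u v))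

    lift₂-e₂-as-xa : e₂ ∈ F₂ → b₂ ∉ drop n₁ B → RankAtLeast G B ∣ F₂ ∣
    lift₂-e₂-as-xa e₂∈ b₂∉ = F' , F'⊆ , connected⇒bondIndep F' connected ,
      injection⇒∣p∣≤∣q∣ F₂ F' e₂↦xa maps (λ _ _ → e₂↦xa-injective)
      where
      F' : Subset (m₁ + m₂)
      F' = ⁅ e₁ ⁆ ++ (F₂ - e₂)
      a₂∈ : a₂ ∈ drop n₁ B
      a₂∈ = [ (λ a₂∈ → a₂∈) , (λ b₂∈ → ⊥-elim (b₂∉ b₂∈)) ]′ (∈δ⇒Joins G₂ (drop n₁ B) joins-e₂ (F₂⊆ e₂∈))
      F'⊆ : F' ⊆ δ G B
      F'⊆ {k} k∈ with side m₁ m₂ k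
      ... | right j with x∈p-y⁻ {p = F₂} (∈-++⁻ʳ {p = ⁅ e₁ ⁆} k∈)
      ...   | j∈ , j≢e₂ = δ-right B j≢e₂ (F₂⊆ j∈)
      F'⊆ {k} k∈ | left i with x∈⁅y⁆⇒x≡y e₁ (∈-++⁻ˡ {q = F₂ - e₂} k∈)
      ...   | refl = Joins⇒∈δ G B joins-xa (inj₂ (∈-drop⁺ a₂∈))
      keep₁' : ∀ {i} → i ≢ e₁ → Restrict₁ (_∉ F') i
      keep₁' i≢e₁ = i≢e₁ , λ k∈ → i≢e₁ (x∈⁅y⁆⇒x≡y e₁ (∈-++⁻ˡ {q = F₂ - e₂} k∈))
      keep₂' : ∀ {j} → j ∉ F₂ → Restrict₂ (_∉ F') j
      keep₂' j∉ = (λ { refl → j∉ e₂∈ }) , λ k∈ → j∉ (proj₁ (x∈p-y⁻ {p = F₂} (∈-++⁻ʳ {p = ⁅ e₁ ⁆} k∈)))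
      connected : ConnectedBy G (_∉ F')
      connected = connected-via-xb (λ xb∈ → proj₂ (x∈p-y⁻ {p = F₂} (∈-++⁻ʳ {p = ⁅ e₁ ⁆} xb∈)) refl)
        (λ u v → path-map keep₁' (G₁-e₁-connected u v)) (λ u v → path-map keep₂' (c₂ u v))
      maps : ∀ {j} → j ∈ F₂ → e₂↦xa j ∈ F'
      maps {j} j∈ with j ≟ e₂
      ... | yes _    = ∈-++⁺ˡ {q = F₂ - e₂} (x∈⁅x⁆ e₁)
      ... | no j≢e₂  = ∈-++⁺ʳ {p = ⁅ e₁ ⁆} (x∈p∧x≢y⇒x∈p-y j∈ j≢e₂)

    lift₂ : RankAtLeast G B ∣ F₂ ∣
    lift₂ with e₂ ∈? F₂ | b₂ ∈? drop n₁ B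
    ... | no e₂∉  | _        = lift₂-avoiding-e₂ e₂∉
    ... | yes e₂∈ | yes b₂∈  = lift₂-e₂-as-xb e₂∈ b₂∈
    ... | yes e₂∈ | no b₂∉   = lift₂-e₂-as-xa e₂∈ b₂∉

  dep⇒dep₂ : ∀ B → OnRight n₁ B → Dep G B → Dep G₂ (drop n₁ B)
  dep⇒dep₂ B onRight dep F₂ F₂⊆ bi =
    ≤-trans (Dep⇒rank≤ dep (lift₂ B F₂ F₂⊆ bi)) (≤-reflexive (sym (OnRight⇒∣drop∣≡∣p∣ onRight)))

  -- The only edge of F outside G₁ - e₁ besides xa can be xb, which is folded onto e₁;
  -- this is injective on F because F never contains both xa and xb.
  module Fold₁ (B : Subset (n₁ + n₂)) (onLeft : OnLeft n₁ B) (F : Subset (m₁ + m₂))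
               (F⊆ : F ⊆ δ G B) (connected : ConnectedBy G (_∉ F)) where

    right∉F : ∀ {j} → j ≢ e₂ → m₁ ↑ʳ j ∉ F
    right∉F j≢e₂ k∈ = [ onLeft _ , onLeft _ ]′ (∈δ⇒Joins G B (joins-right j≢e₂ (inj₁ refl)) (F⊆ k∈))

    ¬xa∈F×xb∈F : xa ∈ F → xb ∈ F → ⊥₀
    ¬xa∈F×xb∈F xa∈ xb∈ = [ (λ (xa∉ , _) → xa∉ xa∈) , (λ (xb∉ , _) → xb∉ xb∈) ]′ (crossing₁ connected a₁)

    left-end∈ : ∀ {k v w} → Joins G k (ι₁ v) (ι₂ w) → k ∈ F → v ∈ take n₁ B
    left-end∈ jk k∈ = ∈-take⁻ ([ (λ v∈ → v∈) , (λ w∈ → ⊥-elim (onLeft _ w∈)) ]′ (∈δ⇒Joins G B jk (F⊆ k∈)))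

    ∈F-view : ∀ {k} → k ∈ F → (Σ (Fin m₁) λ i → k ≡ i ↑ˡ m₂) ⊎ k ≡ xb
    ∈F-view {k} k∈ with side m₁ m₂ k
    ... | left i = inj₁ (i , refl)
    ... | right j with j ≟ e₂
    ...   | yes refl  = inj₂ refl
    ...   | no j≢e₂   = ⊥-elim (right∉F j≢e₂ k∈)

    fold : Subset m₁
    fold with xb ∈? F
    ... | yes _ = take m₁ F ∪ ⁅ e₁ ⁆
    ... | no  _ = take m₁ F

    ∈-fold⁻ : ∀ {i} → i ∈ fold → i ↑ˡ m₂ ∈ F ⊎ (i ≡ e₁ × xb ∈ F)
    ∈-fold⁻ i∈ with xb ∈? F
    ... | yes xb∈ = map-⊎ ∈-take⁺ (λ i∈e₁ → x∈⁅y⁆⇒x≡y e₁ i∈e₁ , xb∈) (x∈p∪q⁻ (take m₁ F) ⁅ e₁ ⁆ i∈)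
    ... | no  _   = inj₁ (∈-take⁺ i∈)

    ∈-fold⁺ : ∀ {k} → k ∈ F → left-or e₁ k ∈ fold
    ∈-fold⁺ k∈ with ∈F-view k∈ | xb ∈? F
    ... | inj₁ (i , refl) | yes _   = subst (_∈ take m₁ F ∪ ⁅ e₁ ⁆) (sym (left-or-↑ˡ e₁ i)) (p⊆p∪q ⁅ e₁ ⁆ (∈-take⁻ k∈))
    ... | inj₁ (i , refl) | no _    = subst (_∈ take m₁ F) (sym (left-or-↑ˡ e₁ i)) (∈-take⁻ k∈)
    ... | inj₂ refl       | yes _   = subst (_∈ take m₁ F ∪ ⁅ e₁ ⁆) (sym (left-or-↑ʳ e₁ e₂)) (q⊆p∪q (take m₁ F) ⁅ e₁ ⁆ (x∈⁅x⁆ e₁))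
    ... | inj₂ refl       | no xb∉  = ⊥-elim (xb∉ k∈)

    folded-onto-e₁ : ∀ {i} → left-or e₁ (i ↑ˡ m₂) ≡ left-or e₁ xb → i ≡ e₁
    folded-onto-e₁ {i} eq = trans (sym (left-or-↑ˡ e₁ i)) (trans eq (left-or-↑ʳ e₁ e₂))

    left-or-injective : ∀ {k k'} → k ∈ F → k' ∈ F → left-or e₁ k ≡ left-or e₁ k' → k ≡ k'
    left-or-injective k∈ k'∈ eq with ∈F-view k∈ | ∈F-view k'∈
    ... | inj₁ (i , refl) | inj₁ (i' , refl) =
      cong (_↑ˡ m₂) (trans (sym (left-or-↑ˡ e₁ i)) (trans eq (left-or-↑ˡ e₁ i')))
    ... | inj₁ (i , refl) | inj₂ refl =
      ⊥-elim (¬xa∈F×xb∈F (subst (λ t → t ↑ˡ m₂ ∈ F) (folded-onto-e₁ eq) k∈) k'∈)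
    ... | inj₂ refl | inj₁ (i' , refl) =
      ⊥-elim (¬xa∈F×xb∈F (subst (λ t → t ↑ˡ m₂ ∈ F) (folded-onto-e₁ (sym eq)) k'∈) k∈)
    ... | inj₂ refl | inj₂ refl = refl

    ∣F∣≤∣fold∣ : ∣ F ∣ ≤ ∣ fold ∣
    ∣F∣≤∣fold∣ = injection⇒∣p∣≤∣q∣ F fold (left-or e₁) ∈-fold⁺ left-or-injective

    fold⊆δ : fold ⊆ δ G₁ (take n₁ B)
    fold⊆δ {i} i∈ with ∈-fold⁻ i∈
    ... | inj₂ (refl , xb∈) =
      Joins⇒∈δ G₁ _ joins-e₁ (inj₂ (left-end∈ joins-xb xb∈))
    ... | inj₁ i∈F with i ≟ e₁
    ...   | no i≢e₁ =
      Joins⇒∈δ G₁ _ (inj₁ refl) (map-⊎ ∈-take⁻ ∈-take⁻ (∈δ⇒Joins G B (joins-left i≢e₁ (inj₁ refl)) (F⊆ i∈F)))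
    ...   | yes refl =
      Joins⇒∈δ G₁ _ joins-e₁ (inj₁ (left-end∈ joins-xa i∈F))

    ∉fold : ∀ {i} → Restrict₁ (_∉ F) i → i ∉ fold
    ∉fold (i≢e₁ , i∉F) i∈ = [ i∉F , (λ (i≡e₁ , _) → i≢e₁ i≡e₁) ]′ (∈-fold⁻ i∈)

    fold-connected : ConnectedBy G₁ (_∉ fold)
    fold-connected = by-cases (xb ∈? F) (xa ∈? F)
      where
      by-cases : Dec (xb ∈ F) → Dec (xa ∈ F) → ConnectedBy G₁ (_∉ fold)
      by-cases (yes xb∈) _ = path-via a₁ λ u →
        [ (λ (_ , p) → path-map ∉fold p) , (λ (xb∉ , _) → ⊥-elim (xb∉ xb∈)) ]′ (crossing₁ connected u)
      by-cases (no _) (yes xa∈) = path-via b₁ λ u →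
        [ (λ (xa∉ , _) → ⊥-elim (xa∉ xa∈)) , (λ (_ , p) → path-map ∉fold p) ]′ (crossing₁ connected u)
      by-cases (no xb∉) (no xa∉) = path-via a₁ λ u →
        [ (λ (_ , p) → path-map ∉fold p)
        , (λ (_ , p) → path-trans (path-map ∉fold p) (path-edge e₁∉ (Joins-sym {G = G₁} joins-e₁))) ]′ (crossing₁ connected u)
        where
        e₁∉ : e₁ ∉ fold
        e₁∉ e₁∈ = [ xa∉ , (λ (_ , xb∈) → xb∉ xb∈) ]′ (∈-fold⁻ e₁∈)

  dep₁⇒dep : ∀ B → OnLeft n₁ B → Dep G₁ (take n₁ B) → Dep G B
  dep₁⇒dep B onLeft dep F F⊆ bi = begin
    ∣ F ∣          ≤⟨ ∣F∣≤∣fold∣ ⟩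
    ∣ fold ∣       ≤⟨ dep fold fold⊆δ (connected⇒bondIndep fold fold-connected) ⟩
    ∣ take n₁ B ∣  ≡⟨ OnLeft⇒∣take∣≡∣p∣ onLeft ⟩
    ∣ B ∣          ∎
    where
    open ≤-Reasoning
    open Fold₁ B onLeft F F⊆ (bondIndep⇒connected G-connected F bi)

  module Fold₂ (B : Subset (n₁ + n₂)) (onRight : OnRight n₁ B) (F : Subset (m₁ + m₂))
               (F⊆ : F ⊆ δ G B) (connected : ConnectedBy G (_∉ F)) where

    left∉F : ∀ {i} → i ≢ e₁ → i ↑ˡ m₂ ∉ F
    left∉F i≢e₁ k∈ = [ onRight _ , onRight _ ]′ (∈δ⇒Joins G B (joins-left i≢e₁ (inj₁ refl)) (F⊆ k∈))

    ¬xa∈F×xb∈F : xa ∈ F → xb ∈ F → ⊥₀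
    ¬xa∈F×xb∈F xa∈ xb∈ = [ (λ (xa∉ , _) → xa∉ xa∈) , (λ (xb∉ , _) → xb∉ xb∈) ]′ (crossing₂ connected a₂)

    right-end∈ : ∀ {k v w} → Joins G k (ι₁ v) (ι₂ w) → k ∈ F → w ∈ drop n₁ B
    right-end∈ jk k∈ = ∈-drop⁻ ([ (λ v∈ → ⊥-elim (onRight _ v∈)) , (λ w∈ → w∈) ]′ (∈δ⇒Joins G B jk (F⊆ k∈)))

    ∈F-view : ∀ {k} → k ∈ F → (Σ (Fin m₂) λ j → k ≡ m₁ ↑ʳ j) ⊎ k ≡ xa
    ∈F-view {k} k∈ with side m₁ m₂ k
    ... | right j = inj₁ (j , refl)
    ... | left i with i ≟ e₁
    ...   | yes refl  = inj₂ refl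
    ...   | no i≢e₁   = ⊥-elim (left∉F i≢e₁ k∈)

    fold : Subset m₂
    fold with xa ∈? F
    ... | yes _ = drop m₁ F ∪ ⁅ e₂ ⁆
    ... | no  _ = drop m₁ F

    ∈-fold⁻ : ∀ {j} → j ∈ fold → m₁ ↑ʳ j ∈ F ⊎ (j ≡ e₂ × xa ∈ F)
    ∈-fold⁻ j∈ with xa ∈? F
    ... | yes xa∈ = map-⊎ ∈-drop⁺ (λ j∈e₂ → x∈⁅y⁆⇒x≡y e₂ j∈e₂ , xa∈) (x∈p∪q⁻ (drop m₁ F) ⁅ e₂ ⁆ j∈)
    ... | no  _   = inj₁ (∈-drop⁺ j∈)

    ∈-fold⁺ : ∀ {k} → k ∈ F → right-or m₁ e₂ k ∈ fold
    ∈-fold⁺ k∈ with ∈F-view k∈ | xa ∈? F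
    ... | inj₁ (j , refl) | yes _   = subst (_∈ drop m₁ F ∪ ⁅ e₂ ⁆) (sym (right-or-↑ʳ m₁ e₂ j)) (p⊆p∪q ⁅ e₂ ⁆ (∈-drop⁻ k∈))
    ... | inj₁ (j , refl) | no _    = subst (_∈ drop m₁ F) (sym (right-or-↑ʳ m₁ e₂ j)) (∈-drop⁻ k∈)
    ... | inj₂ refl       | yes _   = subst (_∈ drop m₁ F ∪ ⁅ e₂ ⁆) (sym (right-or-↑ˡ e₂ e₁)) (q⊆p∪q (drop m₁ F) ⁅ e₂ ⁆ (x∈⁅x⁆ e₂))
    ... | inj₂ refl       | no xa∉  = ⊥-elim (xa∉ k∈)

    folded-onto-e₂ : ∀ {j} → right-or m₁ e₂ (m₁ ↑ʳ j) ≡ right-or m₁ e₂ xa → j ≡ e₂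
    folded-onto-e₂ {j} eq = trans (sym (right-or-↑ʳ m₁ e₂ j)) (trans eq (right-or-↑ˡ e₂ e₁))

    right-or-injective : ∀ {k k'} → k ∈ F → k' ∈ F → right-or m₁ e₂ k ≡ right-or m₁ e₂ k' → k ≡ k'
    right-or-injective k∈ k'∈ eq with ∈F-view k∈ | ∈F-view k'∈
    ... | inj₁ (j , refl) | inj₁ (j' , refl) =
      cong (m₁ ↑ʳ_) (trans (sym (right-or-↑ʳ m₁ e₂ j)) (trans eq (right-or-↑ʳ m₁ e₂ j')))
    ... | inj₁ (j , refl) | inj₂ refl =
      ⊥-elim (¬xa∈F×xb∈F k'∈ (subst (λ t → m₁ ↑ʳ t ∈ F) (folded-onto-e₂ eq) k∈))
    ... | inj₂ refl | inj₁ (j' , refl) =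
      ⊥-elim (¬xa∈F×xb∈F k∈ (subst (λ t → m₁ ↑ʳ t ∈ F) (folded-onto-e₂ (sym eq)) k'∈))
    ... | inj₂ refl | inj₂ refl = refl

    ∣F∣≤∣fold∣ : ∣ F ∣ ≤ ∣ fold ∣
    ∣F∣≤∣fold∣ = injection⇒∣p∣≤∣q∣ F fold (right-or m₁ e₂) ∈-fold⁺ right-or-injective

    fold⊆δ : fold ⊆ δ G₂ (drop n₁ B)
    fold⊆δ {j} j∈ with ∈-fold⁻ j∈
    ... | inj₂ (refl , xa∈) =
      Joins⇒∈δ G₂ _ joins-e₂ (inj₁ (right-end∈ joins-xa xa∈))
    ... | inj₁ j∈F with j ≟ e₂
    ...   | no j≢e₂ =
      Joins⇒∈δ G₂ _ (inj₁ refl) (map-⊎ ∈-drop⁻ ∈-drop⁻ (∈δ⇒Joins G B (joins-right j≢e₂ (inj₁ refl)) (F⊆ j∈F)))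
    ...   | yes refl =
      Joins⇒∈δ G₂ _ joins-e₂ (inj₂ (right-end∈ joins-xb j∈F))

    ∉fold : ∀ {j} → Restrict₂ (_∉ F) j → j ∉ fold
    ∉fold (j≢e₂ , j∉F) j∈ = [ j∉F , (λ (j≡e₂ , _) → j≢e₂ j≡e₂) ]′ (∈-fold⁻ j∈)

    fold-connected : ConnectedBy G₂ (_∉ fold)
    fold-connected = by-cases (xa ∈? F) (xb ∈? F)
      where
      by-cases : Dec (xa ∈ F) → Dec (xb ∈ F) → ConnectedBy G₂ (_∉ fold)
      by-cases (yes xa∈) _ = path-via b₂ λ u →
        [ (λ (xa∉ , _) → ⊥-elim (xa∉ xa∈)) , (λ (_ , p) → path-map ∉fold p) ]′ (crossing₂ connected u)
      by-cases (no _) (yes xb∈) = path-via a₂ λ u →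
        [ (λ (_ , p) → path-map ∉fold p) , (λ (xb∉ , _) → ⊥-elim (xb∉ xb∈)) ]′ (crossing₂ connected u)
      by-cases (no xa∉) (no xb∉) = path-via a₂ λ u →
        [ (λ (_ , p) → path-map ∉fold p)
        , (λ (_ , p) → path-trans (path-map ∉fold p) (path-edge e₂∉ (Joins-sym {G = G₂} joins-e₂))) ]′ (crossing₂ connected u)
        where
        e₂∉ : e₂ ∉ fold
        e₂∉ e₂∈ = [ xb∉ , (λ (_ , xa∈) → xa∉ xa∈) ]′ (∈-fold⁻ e₂∈)

  dep₂⇒dep : ∀ B → OnRight n₁ B → Dep G₂ (drop n₁ B) → Dep G B
  dep₂⇒dep B onRight dep F F⊆ bi = begin
    ∣ F ∣          ≤⟨ ∣F∣≤∣fold∣ ⟩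
    ∣ fold ∣       ≤⟨ dep fold fold⊆δ (connected⇒bondIndep fold fold-connected) ⟩
    ∣ drop n₁ B ∣  ≡⟨ OnRight⇒∣drop∣≡∣p∣ onRight ⟩
    ∣ B ∣          ∎
    where
    open ≤-Reasoning
    open Fold₂ B onRight F F⊆ (bondIndep⇒connected G-connected F bi)

  module TwoSided (A : Subset (n₁ + n₂)) (dep : Dep G A)
    (F₁ : Subset (m₁ + m₂)) (F₁⊆ : F₁ ⊆ δ G (leftHalf n₁ A)) (bi₁ : BondIndep G F₁)
    (big₁ : suc ∣ leftHalf n₁ A ∣ ≤ ∣ F₁ ∣)
    (F₂ : Subset (m₁ + m₂)) (F₂⊆ : F₂ ⊆ δ G (rightHalf n₁ A)) (bi₂ : BondIndep G F₂)
    (big₂ : suc ∣ rightHalf n₁ A ∣ ≤ ∣ F₂ ∣) where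

    private
      c₁ : ConnectedBy G (_∉ F₁)
      c₁ = bondIndep⇒connected G-connected F₁ bi₁

      c₂ : ConnectedBy G (_∉ F₂)
      c₂ = bondIndep⇒connected G-connected F₂ bi₂

      Q₁ : Fin m₁ → Set
      Q₁ = Restrict₁ (_∉ F₁)

      Q₂ : Fin m₂ → Set
      Q₂ = Restrict₂ (_∉ F₂)

      U : Subset (m₁ + m₂)
      U = F₁ ∪ F₂

    right∉F₁ : ∀ {j} → j ≢ e₂ → m₁ ↑ʳ j ∉ F₁
    right∉F₁ j≢e₂ k∈ =
      [ OnLeft-leftHalf {n₁} A _ , OnLeft-leftHalf {n₁} A _ ]′ (∈δ⇒Joins G _ (joins-right j≢e₂ (inj₁ refl)) (F₁⊆ k∈))

    left∉F₂ : ∀ {i} → i ≢ e₁ → i ↑ˡ m₂ ∉ F₂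
    left∉F₂ i≢e₁ k∈ =
      [ OnRight-rightHalf {n₁} A _ , OnRight-rightHalf {n₁} A _ ]′ (∈δ⇒Joins G _ (joins-left i≢e₁ (inj₁ refl)) (F₂⊆ k∈))

    F₁∩F₂⊆new : ∀ {k} → k ∈ F₁ → k ∈ F₂ → k ≡ xa ⊎ k ≡ xb
    F₁∩F₂⊆new {k} k∈₁ k∈₂ with side m₁ m₂ k
    ... | left i with i ≟ e₁
    ...   | yes refl = inj₁ refl
    ...   | no i≢e₁  = ⊥-elim (left∉F₂ i≢e₁ k∈₂)
    F₁∩F₂⊆new {k} k∈₁ k∈₂ | right j with j ≟ e₂
    ...   | yes refl = inj₂ refl
    ...   | no j≢e₂  = ⊥-elim (right∉F₁ j≢e₂ k∈₁)

    meet-xa : xb ∉ F₁ ⊎ xb ∉ F₂ → ∀ {k} → k ∈ F₁ → k ∈ F₂ → k ≡ xa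
    meet-xa xb∉ k∈₁ k∈₂ with F₁∩F₂⊆new k∈₁ k∈₂
    ... | inj₁ k≡xa = k≡xa
    ... | inj₂ refl = ⊥-elim ([ (λ xb∉₁ → xb∉₁ k∈₁) , (λ xb∉₂ → xb∉₂ k∈₂) ]′ xb∉)

    meet-xb : xa ∉ F₁ ⊎ xa ∉ F₂ → ∀ {k} → k ∈ F₁ → k ∈ F₂ → k ≡ xb
    meet-xb xa∉ k∈₁ k∈₂ with F₁∩F₂⊆new k∈₁ k∈₂
    ... | inj₂ k≡xb = k≡xb
    ... | inj₁ refl = ⊥-elim ([ (λ xa∉₁ → xa∉₁ k∈₁) , (λ xa∉₂ → xa∉₂ k∈₂) ]′ xa∉)

    meet-none : xa ∉ F₁ → xb ∉ F₁ → ∀ {z k} → k ∈ F₁ → k ∈ F₂ → k ≡ z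
    meet-none xa∉ xb∉ k∈₁ k∈₂ with F₁∩F₂⊆new k∈₁ k∈₂
    ... | inj₁ refl = ⊥-elim (xa∉ k∈₁)
    ... | inj₂ refl = ⊥-elim (xb∉ k∈₁)

    reach₁ : ReachesEither G₁ Q₁ a₁ b₁
    reach₁ u = map-⊎ proj₂ proj₂ (crossing₁ c₁ u)

    reach₂ : ReachesEither G₂ Q₂ a₂ b₂
    reach₂ u = map-⊎ proj₂ proj₂ (crossing₂ c₂ u)

    ¬xa,xb∈F₁ : xa ∈ F₁ → xb ∈ F₁ → ⊥₀
    ¬xa,xb∈F₁ xa∈ xb∈ = [ (λ (xa∉ , _) → xa∉ xa∈) , (λ (xb∉ , _) → xb∉ xb∈) ]′ (crossing₁ c₁ a₁)

    ¬xa,xb∈F₂ : xa ∈ F₂ → xb ∈ F₂ → ⊥₀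
    ¬xa,xb∈F₂ xa∈ xb∈ = [ (λ (xa∉ , _) → xa∉ xa∈) , (λ (xb∉ , _) → xb∉ xb∈) ]′ (crossing₂ c₂ a₂)

    -- With xa deleted, every vertex of V₁ leaves V₁ through xb, hence reaches b₁ inside G₁.
    xa∈F₁⇒connected₁ : xa ∈ F₁ → ConnectedBy G₁ Q₁
    xa∈F₁⇒connected₁ xa∈ = path-via b₁ λ u → [ (λ (xa∉ , _) → ⊥-elim (xa∉ xa∈)) , proj₂ ]′ (crossing₁ c₁ u)

    xb∈F₁⇒connected₁ : xb ∈ F₁ → ConnectedBy G₁ Q₁
    xb∈F₁⇒connected₁ xb∈ = path-via a₁ λ u → [ proj₂ , (λ (xb∉ , _) → ⊥-elim (xb∉ xb∈)) ]′ (crossing₁ c₁ u)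

    xa∈F₂⇒connected₂ : xa ∈ F₂ → ConnectedBy G₂ Q₂
    xa∈F₂⇒connected₂ xa∈ = path-via b₂ λ u → [ (λ (xa∉ , _) → ⊥-elim (xa∉ xa∈)) , proj₂ ]′ (crossing₂ c₂ u)

    xb∈F₂⇒connected₂ : xb ∈ F₂ → ConnectedBy G₂ Q₂
    xb∈F₂⇒connected₂ xb∈ = path-via a₂ λ u → [ proj₂ , (λ (xb∉ , _) → ⊥-elim (xb∉ xb∈)) ]′ (crossing₂ c₂ u)

    glued-absurd : ∀ F z → F ⊆ U → ConnectedBy G (_∉ F) →
      (∀ {k} → k ∈ F₁ → k ∈ F₂ → k ≡ z) → (∀ {k} → k ∈ F₁ ⊎ k ∈ F₂ → k ≢ z → k ∈ F) →
      (z ∈ F₁ → z ∈ F₂ → z ∈ F) → ⊥₀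
    glued-absurd F z F⊆U connected meet kept shared =
      glue-absurd big₁ big₂
        (glue-bound F₁ F₂ F z meet kept shared)
        (dep F F⊆δ (connected⇒bondIndep F connected))
        (≤-trans (p⊆q⇒∣p∣≤∣q∣ (⊆leftHalf∪rightHalf {n₁} A)) (∣p∪q∣≤∣p∣+∣q∣ (leftHalf n₁ A) (rightHalf n₁ A)))
      where
      F⊆δ : F ⊆ δ G A
      F⊆δ k∈ = [ (λ k∈₁ → δ-mono G (leftHalf⊆ {n₁} A) (F₁⊆ k∈₁)) , (λ k∈₂ → δ-mono G (rightHalf⊆ {n₁} A) (F₂⊆ k∈₂)) ]′
                 (x∈p∪q⁻ F₁ F₂ (F⊆U k∈))

    U-absurd : ∀ z → (∀ {k} → k ∈ F₁ → k ∈ F₂ → k ≡ z) → ConnectedBy G (_∉ U) → ⊥₀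
    U-absurd z meet connected =
      glued-absurd U z (λ k∈ → k∈) connected meet (λ k∈ _ → x∈p∪q⁺ k∈) (λ z∈₁ _ → x∈p∪q⁺ (inj₁ z∈₁))

    U-z-absurd : ∀ z → (∀ {k} → k ∈ F₁ → k ∈ F₂ → k ≡ z) → ¬ (z ∈ F₁ × z ∈ F₂) →
      ConnectedBy G (_∉ U - z) → ⊥₀
    U-z-absurd z meet unshared connected =
      glued-absurd (U - z) z (p─q⊆p U ⁅ z ⁆) connected meet
        (λ k∈ k≢z → x∈p∧x≢y⇒x∈p-y (x∈p∪q⁺ k∈) k≢z) (λ z∈₁ z∈₂ → ⊥-elim (unshared (z∈₁ , z∈₂)))

    module _ {F : Subset (m₁ + m₂)} (F⊆U : F ⊆ U) where

      restrict₁ : ∀ {i} → Q₁ i → Restrict₁ (_∉ F) i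
      restrict₁ (i≢e₁ , i∉F₁) = i≢e₁ , λ k∈ → [ i∉F₁ , left∉F₂ i≢e₁ ]′ (x∈p∪q⁻ F₁ F₂ (F⊆U k∈))

      restrict₂ : ∀ {j} → Q₂ j → Restrict₂ (_∉ F) j
      restrict₂ (j≢e₂ , j∉F₂) = j≢e₂ , λ k∈ → [ right∉F₁ j≢e₂ , j∉F₂ ]′ (x∈p∪q⁻ F₁ F₂ (F⊆U k∈))

      connected₁ : ConnectedBy G₁ Q₁ → ConnectedBy G₁ (Restrict₁ (_∉ F))
      connected₁ c u v = path-map restrict₁ (c u v)

      connected₂ : ConnectedBy G₂ Q₂ → ConnectedBy G₂ (Restrict₂ (_∉ F))
      connected₂ c u v = path-map restrict₂ (c u v)

      reaches₁ : ReachesEither G₁ (Restrict₁ (_∉ F)) a₁ b₁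
      reaches₁ = reaches-map restrict₁ reach₁

      reaches₂ : ReachesEither G₂ (Restrict₂ (_∉ F)) a₂ b₂
      reaches₂ = reaches-map restrict₂ reach₂

      ∉F : ∀ {k} → k ∉ F₁ → k ∉ F₂ → k ∉ F
      ∉F k∉₁ k∉₂ k∈ = [ k∉₁ , k∉₂ ]′ (x∈p∪q⁻ F₁ F₂ (F⊆U k∈))

    U-z⊆U : ∀ {z} → U - z ⊆ U
    U-z⊆U {z} = p─q⊆p U ⁅ z ⁆

    z∉U-z : ∀ {z} → z ∉ U - z
    z∉U-z z∈ = proj₂ (x∈p-y⁻ {p = U} z∈) refl

    absurd-xa∈F₁ : xa ∈ F₁ → xb ∉ F₁ → ⊥₀
    absurd-xa∈F₁ xa∈₁ xb∉₁ with xa ∈? F₂ | xb ∈? F₂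
    ... | yes xa∈₂ | yes xb∈₂ = ¬xa,xb∈F₂ xa∈₂ xb∈₂
    ... | yes xa∈₂ | no xb∉₂ =
      U-absurd xa (meet-xa (inj₁ xb∉₁))
        (connected-via-xb (∉F ⊆-refl xb∉₁ xb∉₂)
          (connected₁ ⊆-refl (xa∈F₁⇒connected₁ xa∈₁)) (connected₂ ⊆-refl (xa∈F₂⇒connected₂ xa∈₂)))
    ... | no xa∉₂ | yes xb∈₂ =
      U-z-absurd xb (meet-xb (inj₂ xa∉₂)) (λ (xb∈₁ , _) → xb∉₁ xb∈₁)
        (connected-via-xb z∉U-z
          (connected₁ U-z⊆U (xa∈F₁⇒connected₁ xa∈₁)) (connected₂ U-z⊆U (xb∈F₂⇒connected₂ xb∈₂)))
    ... | no xa∉₂ | no xb∉₂ =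
      U-z-absurd xa (meet-xa (inj₁ xb∉₁)) (λ (_ , xa∈₂) → xa∉₂ xa∈₂)
        (connected-via-both z∉U-z (∉F U-z⊆U xb∉₁ xb∉₂)
          (connected⇒reaches c) (reaches₂ U-z⊆U) (inj₁ (c a₁ b₁)))
      where c = connected₁ U-z⊆U (xa∈F₁⇒connected₁ xa∈₁)

    absurd-xb∈F₁ : xb ∈ F₁ → xa ∉ F₁ → ⊥₀
    absurd-xb∈F₁ xb∈₁ xa∉₁ with xa ∈? F₂ | xb ∈? F₂
    ... | yes xa∈₂ | yes xb∈₂ = ¬xa,xb∈F₂ xa∈₂ xb∈₂
    ... | no xa∉₂ | yes xb∈₂ =
      U-absurd xb (meet-xb (inj₁ xa∉₁))
        (connected-via-xa (∉F ⊆-refl xa∉₁ xa∉₂)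
          (connected₁ ⊆-refl (xb∈F₁⇒connected₁ xb∈₁)) (connected₂ ⊆-refl (xb∈F₂⇒connected₂ xb∈₂)))
    ... | yes xa∈₂ | no xb∉₂ =
      U-z-absurd xb (meet-xb (inj₁ xa∉₁)) (λ (_ , xb∈₂) → xb∉₂ xb∈₂)
        (connected-via-xb z∉U-z
          (connected₁ U-z⊆U (xb∈F₁⇒connected₁ xb∈₁)) (connected₂ U-z⊆U (xa∈F₂⇒connected₂ xa∈₂)))
    ... | no xa∉₂ | no xb∉₂ =
      U-z-absurd xb (meet-xb (inj₁ xa∉₁)) (λ (_ , xb∈₂) → xb∉₂ xb∈₂)
        (connected-via-both (∉F U-z⊆U xa∉₁ xa∉₂) z∉U-z
          (connected⇒reaches c) (reaches₂ U-z⊆U) (inj₁ (c a₁ b₁)))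
      where c = connected₁ U-z⊆U (xb∈F₁⇒connected₁ xb∈₁)

    AvoidingBut : Fin m₁ → Fin m₁ → Set
    AvoidingBut f i = i ≢ e₁ × (i ↑ˡ m₂ ∉ F₁ ⊎ i ≡ f)

    -- Walk from a₁ towards b₁ in G₁ - e₁ while the vertices reach a₁ avoiding F₁.  If this
    -- stops, it stops at an edge f ∈ F₁ whose far end reaches b₁ avoiding F₁, so b₁ reaches
    -- a₁ with f as the only edge of F₁ used.
    b₁-to-a₁ : Path G₁ Q₁ b₁ a₁ ⊎ Σ (Fin m₁) λ f → f ≢ e₁ × f ↑ˡ m₂ ∈ F₁ × Path G₁ (AvoidingBut f) b₁ a₁
    b₁-to-a₁ = walk (G₁-e₁-connected a₁ b₁)
      where
      walk : ∀ {t} → Path G₁ (_≢ e₁) a₁ t →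
        Path G₁ Q₁ t a₁ ⊎ Σ (Fin m₁) λ f → f ≢ e₁ × f ↑ˡ m₂ ∈ F₁ × Path G₁ (AvoidingBut f) b₁ a₁
      walk nil = inj₁ nil
      walk (cons {g} {s} {t} g≢e₁ jn p) with walk p
      ... | inj₂ r = inj₂ r
      ... | inj₁ s→a₁ with g ↑ˡ m₂ ∈? F₁
      ...   | no g∉ = inj₁ (path-trans (path-edge (g≢e₁ , g∉) (Joins-sym {G = G₁} jn)) s→a₁)
      ...   | yes g∈ with reach₁ t
      ...     | inj₁ t→a₁ = inj₁ t→a₁
      ...     | inj₂ t→b₁ = inj₂ (g , g≢e₁ , g∈ ,
                  path-trans (path-sym (path-map widen t→b₁))
                    (path-trans (path-edge (g≢e₁ , inj₂ refl) (Joins-sym {G = G₁} jn)) (path-map widen s→a₁)))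
        where
        widen : ∀ {i} → Q₁ i → AvoidingBut g i
        widen (i≢e₁ , i∉) = i≢e₁ , inj₁ i∉

    absurd-new∉ : xa ∉ F₁ → xb ∉ F₁ → xa ∉ F₂ → xb ∉ F₂ → ⊥₀
    absurd-new∉ xa∉₁ xb∉₁ xa∉₂ xb∉₂ with b₁-to-a₁
    ... | inj₁ b₁→a₁ =
      U-absurd xa (meet-none xa∉₁ xb∉₁)
        (connected-via-both (∉F ⊆-refl xa∉₁ xa∉₂) (∉F ⊆-refl xb∉₁ xb∉₂) (reaches₁ ⊆-refl) (reaches₂ ⊆-refl)
          (inj₁ (path-sym (path-map (restrict₁ ⊆-refl) b₁→a₁))))
    ... | inj₂ (f , f≢e₁ , f∈ , b₁→a₁) =
      U-z-absurd z (meet-none xa∉₁ xb∉₁) (λ (_ , z∈₂) → left∉F₂ f≢e₁ z∈₂)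
        (connected-via-both (∉F U-z⊆U xa∉₁ xa∉₂) (∉F U-z⊆U xb∉₁ xb∉₂) to-a₁ (reaches₂ U-z⊆U) (inj₁ (path-sym b₁→a₁')))
      where
      z : Fin (m₁ + m₂)
      z = f ↑ˡ m₂
      narrow : ∀ {i} → AvoidingBut f i → Restrict₁ (_∉ U - z) i
      narrow (i≢e₁ , inj₁ i∉) = restrict₁ U-z⊆U (i≢e₁ , i∉)
      narrow (i≢e₁ , inj₂ refl) = i≢e₁ , z∉U-z
      b₁→a₁' : Path G₁ (Restrict₁ (_∉ U - z)) b₁ a₁
      b₁→a₁' = path-map narrow b₁→a₁
      to-a₁ : ReachesEither G₁ (Restrict₁ (_∉ U - z)) a₁ b₁
      to-a₁ u = inj₁ ([ path-map (restrict₁ U-z⊆U) , (λ p → path-trans (path-map (restrict₁ U-z⊆U) p) b₁→a₁') ]′ (reach₁ u))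

    absurd-xa,xb∉F₁ : xa ∉ F₁ → xb ∉ F₁ → ⊥₀
    absurd-xa,xb∉F₁ xa∉₁ xb∉₁ with xa ∈? F₂ | xb ∈? F₂
    ... | yes xa∈₂ | yes xb∈₂ = ¬xa,xb∈F₂ xa∈₂ xb∈₂
    ... | yes xa∈₂ | no xb∉₂ =
      U-z-absurd xa (meet-none xa∉₁ xb∉₁) (λ (xa∈₁ , _) → xa∉₁ xa∈₁)
        (connected-via-both z∉U-z (∉F U-z⊆U xb∉₁ xb∉₂) (reaches₁ U-z⊆U) (connected⇒reaches c) (inj₂ (c a₂ b₂)))
      where c = connected₂ U-z⊆U (xa∈F₂⇒connected₂ xa∈₂)
    ... | no xa∉₂ | yes xb∈₂ =
      U-z-absurd xb (meet-none xa∉₁ xb∉₁) (λ (xb∈₁ , _) → xb∉₁ xb∈₁)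
        (connected-via-both (∉F U-z⊆U xa∉₁ xa∉₂) z∉U-z (reaches₁ U-z⊆U) (connected⇒reaches c) (inj₂ (c a₂ b₂)))
      where c = connected₂ U-z⊆U (xb∈F₂⇒connected₂ xb∈₂)
    ... | no xa∉₂ | no xb∉₂ = absurd-new∉ xa∉₁ xb∉₁ xa∉₂ xb∉₂

    absurd : ⊥₀
    absurd with xa ∈? F₁ | xb ∈? F₁
    ... | yes xa∈₁ | yes xb∈₁ = ¬xa,xb∈F₁ xa∈₁ xb∈₁
    ... | yes xa∈₁ | no xb∉₁  = absurd-xa∈F₁ xa∈₁ xb∉₁
    ... | no xa∉₁  | yes xb∈₁ = absurd-xb∈F₁ xb∈₁ xa∉₁
    ... | no xa∉₁  | no xb∉₁  = absurd-xa,xb∉F₁ xa∉₁ xb∉₁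

  two-sided-absurd : ∀ A → Dep G A →
    RankAtLeast G (leftHalf n₁ A) (suc ∣ leftHalf n₁ A ∣) → RankAtLeast G (rightHalf n₁ A) (suc ∣ rightHalf n₁ A ∣) → ⊥₀
  two-sided-absurd A dep (F₁ , F₁⊆ , bi₁ , big₁) (F₂ , F₂⊆ , bi₂ , big₂) =
    TwoSided.absurd A dep F₁ F₁⊆ bi₁ big₁ F₂ F₂⊆ bi₂ big₂

  dep⇔SideDep : ∀ B (oneSided : OneSided n₁ B) → Dep G B ⇔ SideDep G₁ G₂ B oneSided
  dep⇔SideDep B (inj₁ onLeft)  = mk⇔ (dep⇒dep₁ B onLeft) (dep₁⇒dep B onLeft)
  dep⇔SideDep B (inj₂ onRight) = mk⇔ (dep⇒dep₂ B onRight) (dep₂⇒dep B onRight)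

  circuit-oneSided : ∀ A → IsCircuit G A → OneSided n₁ A
  circuit-oneSided A (_ , dep , minimal) with all? (λ j → ¬? (n₁ ↑ʳ j ∈? A)) | all? (λ i → ¬? (i ↑ˡ n₂ ∈? A))
  ... | yes onLeft  | _           = inj₁ onLeft
  ... | no _        | yes onRight = inj₂ onRight
  ... | no ¬onLeft  | no ¬onRight =
    ⊥-elim (¬¬rank₁ λ rank₁ → ¬¬rank₂ λ rank₂ → two-sided-absurd A dep rank₁ rank₂)
    where
    right∈A : Σ (Fin n₂) λ j → n₁ ↑ʳ j ∈ A
    right∈A = map₂ (decidable-stable (_ ∈? A)) (¬∀⟶∃¬ n₂ _ (λ j → ¬? (n₁ ↑ʳ j ∈? A)) ¬onLeft)
    left∈A : Σ (Fin n₁) λ i → i ↑ˡ n₂ ∈ A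
    left∈A = map₂ (decidable-stable (_ ∈? A)) (¬∀⟶∃¬ n₁ _ (λ i → ¬? (i ↑ˡ n₂ ∈? A)) ¬onRight)
    ¬¬rank₁ : ¬ ¬ RankAtLeast G (leftHalf n₁ A) (suc ∣ leftHalf n₁ A ∣)
    ¬¬rank₁ ¬rank
      with minimal (leftHalf n₁ A) (_ , x∈p∩q⁺ (proj₂ left∈A , ∈-++⁺ˡ ∈⊤)) (leftHalf⊆ {n₁} A) (¬rank>⇒Dep ¬rank)
    ... | half≡A = OnLeft-leftHalf {n₁} A (proj₁ right∈A) (subst (n₁ ↑ʳ proj₁ right∈A ∈_) (sym half≡A) (proj₂ right∈A))
    ¬¬rank₂ : ¬ ¬ RankAtLeast G (rightHalf n₁ A) (suc ∣ rightHalf n₁ A ∣)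
    ¬¬rank₂ ¬rank
      with minimal (rightHalf n₁ A) (_ , x∈p∩q⁺ (proj₂ right∈A , ∈-++⁺ʳ {p = ⊥ {n₁}} ∈⊤)) (rightHalf⊆ {n₁} A) (¬rank>⇒Dep ¬rank)
    ... | half≡A = OnRight-rightHalf {n₁} A (proj₁ left∈A) (subst (proj₁ left∈A ↑ˡ n₂ ∈_) (sym half≡A) (proj₂ left∈A))

circuit-transfer : ∀ {n₁ n₂ m₁ m₂} {G₁ : Graph n₁ m₁} {G₂ : Graph n₂ m₂} →
  TwoEdgeConnected G₁ → TwoEdgeConnected G₂ → (s s' : Switch G₁ G₂) →
  ∀ A → IsCircuit (Switch.graph s) A → IsCircuit (Switch.graph s') A
circuit-transfer tec₁ tec₂ s s' A circuit@(nonempty , dep , minimal) =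
  nonempty , transfer A oneSided dep ,
  λ B B≢∅ B⊆A depB → minimal B B≢∅ B⊆A (transfer⁻ B (OneSided-⊆ B⊆A oneSided) depB)
  where
  module S  = TwoSwitch tec₁ tec₂ s
  module S' = TwoSwitch tec₁ tec₂ s'
  oneSided = S.circuit-oneSided A circuit
  transfer : ∀ B oneSided → Dep S.G B → Dep S'.G B
  transfer B oneSided = Equivalence.from (S'.dep⇔SideDep B oneSided) ∘ Equivalence.to (S.dep⇔SideDep B oneSided)
  transfer⁻ : ∀ B oneSided → Dep S'.G B → Dep S.G B
  transfer⁻ B oneSided = Equivalence.from (S.dep⇔SideDep B oneSided) ∘ Equivalence.to (S'.dep⇔SideDep B oneSided)

corollary5p3 : ∀ {n₁ n₂ m₁ m₂} (G₁ : Graph n₁ m₁) (G₂ : Graph n₂ m₂) →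
    Trivalent G₁ → Trivalent G₂ →
    TwoEdgeConnected G₁ → TwoEdgeConnected G₂ →
    (e₁ : Fin m₁) (a₁ b₁ : Fin n₁) → Joins G₁ e₁ a₁ b₁ →
    (e₂ : Fin m₂) (a₂ b₂ : Fin n₂) → Joins G₂ e₂ a₂ b₂ →
    (e₁' : Fin m₁) (a₁' b₁' : Fin n₁) → Joins G₁ e₁' a₁' b₁' →
    (e₂' : Fin m₂) (a₂' b₂' : Fin n₂) → Joins G₂ e₂' a₂' b₂' →
    SameCurveMatroid (twoSwitch G₁ G₂ e₁ a₁ b₁ e₂ a₂ b₂)
                     (twoSwitch G₁ G₂ e₁' a₁' b₁' e₂' a₂' b₂')
corollary5p3 G₁ G₂ _ _ tec₁ tec₂ e₁ a₁ b₁ joins-e₁ e₂ a₂ b₂ joins-e₂ e₁' a₁' b₁' joins-e₁' e₂' a₂' b₂' joins-e₂' A =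
  mk⇔ (circuit-transfer tec₁ tec₂ s s' A) (circuit-transfer tec₁ tec₂ s' s A)
  where
  s s' : Switch G₁ G₂
  s  = record { e₁ = e₁  ; a₁ = a₁  ; b₁ = b₁  ; joins-e₁ = joins-e₁
              ; e₂ = e₂  ; a₂ = a₂  ; b₂ = b₂  ; joins-e₂ = joins-e₂ }
  s' = record { e₁ = e₁' ; a₁ = a₁' ; b₁ = b₁' ; joins-e₁ = joins-e₁'
              ; e₂ = e₂' ; a₂ = a₂' ; b₂ = b₂' ; joins-e₂ = joins-e₂' }
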